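{- Let $r$ be a positive integer and let $G_1,\dots,G_m$, $H_1,\dots,H_m$ and $G$ be graphs. If $H_i$ has zero $G_i$-slice density for each $i\in[m]$ and $G\xrightarrow{r}\{G_1,\dots,G_m\}$, then $G^{\square N}\xrightarrow{r}\{H_1,\dots,H_m\}$ for every sufficiently large integer $N$. Similarly, if $H_i$ has zero induced $G_i$-slice density for each $i\in[m]$ and $G\xrightarrow{r}_{\mathrm{ind}}\{G_1,\dots,G_m\}$, then $G^{\square N}\xrightarrow{r}_{\mathrm{ind}}\{H_1,\dots,H_m\}$ for every sufficiently large integer $N$.
   Context: Graphs are finite. The Cartesian product $G\square H$ has vertex set $V(G)\times V(H)$, with $(x_1,x_2)(y_1,y_2)$ an edge iff either $x_1y_1\in E(G)$ and $x_2=y_2$, or $x_1=y_1$ and $x_2y_2\in E(H)$; $G^{\square 1}=G$ and $G^{\square N}=G^{\square (N-1)}\square G$. A $G$-slice of $G^{\square N}$ is a subgraph induced by a Cartesian product of $V(G)$ and $N-1$ one-element subsets of $V(G)$, in any order of the coordinates (there are $N|V(G)|^{N-1}$ of them). A graph $H$ has zero (induced) $G$-slice density if for every $\varepsilon>0$ there is $N_0$ such that for every $N\geq N_0$, every subgraph of $G^{\square N}$ that contains at least an $\varepsilon$-fraction of the $G$-slices of $G^{\square N}$ contains an (induced) copy of $H$. For a graph $G$, a family $\mathcal F$ of graphs and a positive integer $r$, $G\xrightarrow{r}\mathcal F$ (resp. $G\xrightarrow{r}_{\mathrm{ind}}\mathcal F$) means that every $r$-coloring of $V(G)$ contains a monochromatic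 copy (resp. induced copy) of some graph in $\mathcal F$. -}

module Defs where

open import Data.Bool using (Bool; true; false; _∧_; _∨_; not; if_then_else_)
open import Data.Nat using (ℕ; zero; suc; _*_; _^_)
open import Data.Fin using (Fin)
open import Data.Vec using (Vec; []; _∷_; insertAt)
open import Data.List using (List; []; _∷_; map; concatMap; allFin; cartesianProduct)
open import Data.Nat.ListAction using (sum)
open import Data.Product using (Σ; ∃; _×_; _,_; proj₁)
open import Data.Sum using (_⊎_)
open import Data.Empty using (⊥)
open import Data.Integer using (+_)
open import Data.Rational using (ℚ; _/_)
open import Function.Definitions using (Injective)
open import Relation.Binary.PropositionalEquality using (_≡_)

record Graph : Set where
  field
    n      : ℕ
    adj    : Fin n → Fin n → Bool
    sym    : ∀ x y → adj x y ≡ adj y x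
    irrefl : ∀ x → adj x x ≡ false
open Graph public

Edge : (G : Graph) → Fin (n G) → Fin (n G) → Set
Edge G x y = adj G x y ≡ true

record Copy (H : Graph) (V : Set) (E : V → V → Set) : Set where
  field
    φ    : Fin (n H) → V
    inj  : Injective _≡_ _≡_ φ
    pres : ∀ u v → Edge H u v → E (φ u) (φ v)

record IndCopy (H : Graph) (V : Set) (E : V → V → Set) : Set where
  field
    φ    : Fin (n H) → V
    inj  : Injective _≡_ _≡_ φ
    pres : ∀ u v → Edge H u v → E (φ u) (φ v)
    refl : ∀ u v → E (φ u) (φ v) → Edge H u v

-- Cartesian power G^{□N}: vertices Vec (Fin n) N; built by iterating the
-- Cartesian product (G^{□0} is the one-vertex graph, G^{□(N+1)} = G □ G^{□N}).

PowV : Graph → ℕ → Set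
PowV G N = Vec (Fin (n G)) N

PowE : (G : Graph) (N : ℕ) → PowV G N → PowV G N → Set
PowE G zero    _       _       = ⊥
PowE G (suc N) (x ∷ u) (y ∷ v) = (Edge G x y × u ≡ v) ⊎ (x ≡ y × PowE G N u v)

record Subgraph (G : Graph) (N : ℕ) : Set where
  field
    Vs      : PowV G N → Bool
    Es      : PowV G N → PowV G N → Bool
    Es-sym  : ∀ u v → Es u v ≡ Es v u
    Es-edge : ∀ u v → Es u v ≡ true → PowE G N u v
    Es-end  : ∀ u v → Es u v ≡ true → Vs u ≡ true
open Subgraph public

SubV : ∀ {G N} → Subgraph G N → Set
SubV {G} {N} S = Σ (PowV G N) λ u → Vs S u ≡ true

SubE : ∀ {G N} (S : Subgraph G N) → SubV S → SubV S → Set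
SubE S a b = Es S (proj₁ a) (proj₁ b) ≡ true

-- G-slices of G^{□(suc M)}: for a direction i : Fin (suc M) and the
-- values c : Vec (Fin n) M of the remaining M coordinates, the slice has
-- vertices  insertAt c i x  (x ∈ V(G)), and (as an induced subgraph of
-- G^{□N}) edges  insertAt c i x ~ insertAt c i y  for xy ∈ E(G).

allVecs : (k M : ℕ) → List (Vec (Fin k) M)
allVecs k zero    = [] ∷ []
allVecs k (suc M) = concatMap (λ x → map (x ∷_) (allVecs k M)) (allFin k)

allB : {A : Set} → (A → Bool) → List A → Bool
allB p []       = true
allB p (x ∷ xs) = p x ∧ allB p xs

containsSlice : ∀ {G M} → Subgraph G (suc M) → Fin (suc M) → PowV G M → Bool
containsSlice {G} S i c =
  allB (λ x → Vs S (insertAt c i x)) (allFin (n G)) ∧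
  allB (λ x → allB (λ y → not (adj G x y) ∨ Es S (insertAt c i x) (insertAt c i y))
                 (allFin (n G)))
      (allFin (n G))

slicesIn : ∀ {G M} → Subgraph G (suc M) → ℕ
slicesIn {G} {M} S =
  sum (map (λ p → if containsSlice S (proj₁ p) (Data.Product.proj₂ p) then 1 else 0)
           (cartesianProduct (allFin (suc M)) (allVecs (n G) M)))

totalSlices : Graph → ℕ → ℕ
totalSlices G M = suc M * (n G ^ M)

toℚ : ℕ → ℚ
toℚ k = + k / 1

-- zero (induced) G-slice density
-- (N ranges over N = suc M ≥ 1, where G-slices are defined)

ZeroSliceDensity : (H G : Graph) → Set
ZeroSliceDensity H G =
  ∀ (ε : ℚ) → Data.Rational._<_ (+ 0 / 1) ε →
  ∃ λ N₀ → ∀ M → Data.Nat._≤_ N₀ (suc M) →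
    ∀ (S : Subgraph G (suc M)) →
    Data.Rational._≤_ (Data.Rational._*_ ε (toℚ (totalSlices G M))) (toℚ (slicesIn S)) →
    Copy H (SubV S) (SubE S)

ZeroIndSliceDensity : (H G : Graph) → Set
ZeroIndSliceDensity H G =
  ∀ (ε : ℚ) → Data.Rational._<_ (+ 0 / 1) ε →
  ∃ λ N₀ → ∀ M → Data.Nat._≤_ N₀ (suc M) →
    ∀ (S : Subgraph G (suc M)) →
    Data.Rational._≤_ (Data.Rational._*_ ε (toℚ (totalSlices G M))) (toℚ (slicesIn S)) →
    IndCopy H (SubV S) (SubE S)

Arrow : (r : ℕ) (V : Set) (E : V → V → Set) {m : ℕ} → (Fin m → Graph) → Set
Arrow r V E {m} F =
  ∀ (χ : V → Fin r) → Σ (Fin m) λ i → Σ (Copy (F i) V E) λ c →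
    ∃ λ (k : Fin r) → ∀ u → χ (Copy.φ c u) ≡ k

ArrowInd : (r : ℕ) (V : Set) (E : V → V → Set) {m : ℕ} → (Fin m → Graph) → Set
ArrowInd r V E {m} F =
  ∀ (χ : V → Fin r) → Σ (Fin m) λ i → Σ (IndCopy (F i) V E) λ c →
    ∃ λ (k : Fin r) → ∀ u → χ (IndCopy.φ c u) ≡ k

{-# OPTIONS --safe #-}

-- Let T be the number of G-slices of G^□N.  Each G-slice carries a monochromatic copy of some G i,
-- so pigeonholing yields i, an embedding φ : G i → G and a colour k such that at least T / C of the
-- G-slices contain a k-coloured image of φ, with C independent of N.  Treating the coordinates of
-- G^□N one at a time, each either ranges over the image of φ (and becomes a coordinate of G i) or
-- is fixed to one of the q = |G| - |G i| other vertices; this embeds (q + 1)^N products (G i)^□a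
-- into G^□N, and their G i-slices are exactly the images of φ inside G-slices.  Choose s beyond
-- the thresholds of zero G i-slice density at ε = 1 / D.  If no k-coloured copy of H i exists, each
-- product with a ≥ s has fewer than a 1 / D fraction of k-coloured G i-slices, and the products
-- with a < s are negligibly few; hence D T / C ≤ T + o(T), which fails for D = 2C + 1.

module Submission where

open import Axiom.UniquenessOfIdentityProofs using (module Decidable⇒UIP)
open import Data.Bool using (Bool; true; false; _∧_; _∨_; not; if_then_else_)
import Data.Bool.Properties as Bool
open import Data.Empty using (⊥; ⊥-elim)
open import Data.Fin using (Fin; zero; suc; fromℕ<)
import Data.Fin.Properties as Fin
import Data.Integer as ℤ using (+_; _*_; _≤_; +≤+; +<+)
import Data.Integer.Properties as ℤ using (*-identityˡ; *-identityʳ; pos-*)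
import Data.List as List hiding (sum)
import Data.List.Properties as List using (map-++; map-∘; map-tabulate)
open import Data.Nat
  using (ℕ; zero; suc; _+_; _*_; _^_; _≤_; _<_; _∸_; z≤n; s≤s; _≤?_; _≟_; NonZero; >-nonZero⁻¹)
import Data.Nat.ListAction as List using (sum)
import Data.Nat.ListAction.Properties as List using (sum-++)
open import Data.Nat.Properties
open import Algebra.Properties.CommutativeSemigroup +-commutativeSemigroup
  using () renaming (interchange to +-interchange)
open import Algebra.Properties.Semiring.Sum +-*-semiring
  using (sum; sum-syntax; sum-cong-≗; sum-replicate-zero; ∑-distrib-+; ∑-comm; *-distribˡ-sum)
open import Data.Nat.Solver using (module +-*-Solver)
open +-*-Solver using (solve; _:*_; _:+_; con; _:=_)
open import Data.Product using (Σ; ∃; _×_; _,_; proj₁; proj₂)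
open import Data.Rational using (ℚ; _/_)
import Data.Rational as ℚ using (_*_; _≤_; _<_; toℚᵘ)
import Data.Rational.Properties as ℚ using (toℚᵘ-cancel-≤; toℚᵘ-cancel-<; toℚᵘ-fromℚᵘ; toℚᵘ-homo-*)
open import Data.Rational.Unnormalised using (mkℚᵘ; *≤*; *<*)
import Data.Rational.Unnormalised as ℚᵘ using (_≃_; _*_)
import Data.Rational.Unnormalised.Properties as ℚᵘ
  using (≤-respˡ-≃; ≤-respʳ-≃; <-respˡ-≃; <-respʳ-≃; ≃-sym; ≃-trans; *-cong)
open import Data.Sum using (_⊎_; inj₁; inj₂; [_,_]′)
open import Data.Unit using (⊤; tt)
open import Data.Vec using (Vec; []; _∷_; _++_; insertAt; lookup; tabulate; replicate)
import Data.Vec.Properties as Vec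
open import Function using (_∘_; mk⇔)
open import Function.Definitions using (Injective)
open import Relation.Binary.PropositionalEquality
open import Relation.Nullary using (Dec; yes; no; ¬_; does)
open import Relation.Nullary.Decidable using (_×-dec_; _⊎-dec_; _→-dec_; map′; dec-true; does-⇔)

open import Defs hiding (sym)

-- Sums over cubes [k]^N and over their slices

sum-mono-≤ : ∀ {k} {f g : Fin k → ℕ} → (∀ x → f x ≤ g x) → sum f ≤ sum g
sum-mono-≤ {zero}  h = z≤n
sum-mono-≤ {suc k} h = +-mono-≤ (h zero) (sum-mono-≤ (h ∘ suc))

sum-const : ∀ k c → ∑[ _ < k ] c ≡ k * c
sum-const zero    c = refl
sum-const (suc k) c = cong (c +_) (sum-const k c)

term≤sum : ∀ {k} (f : Fin k → ℕ) x → f x ≤ sum f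
term≤sum f zero    = m≤m+n _ _
term≤sum f (suc x) = ≤-trans (term≤sum (f ∘ suc) x) (m≤n+m _ _)

*-distribʳ-sum : ∀ {k} c (f : Fin k → ℕ) → ∑[ x < k ] (f x * c) ≡ sum f * c
*-distribʳ-sum c f = trans (sum-cong-≗ (λ x → *-comm (f x) c)) (trans (sym (*-distribˡ-sum c f)) (*-comm c _))

indicator : Bool → ℕ
indicator b = if b then 1 else 0

sumCube : (k N : ℕ) → (Vec (Fin k) N → ℕ) → ℕ
sumCube k zero    f = f []
sumCube k (suc N) f = ∑[ v < k ] sumCube k N (f ∘ (v ∷_))

module _ {k : ℕ} where

  sumCube-cong : ∀ N {f g : Vec (Fin k) N → ℕ} → (∀ x → f x ≡ g x) → sumCube k N f ≡ sumCube k N g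
  sumCube-cong zero    h = h []
  sumCube-cong (suc N) h = sum-cong-≗ (λ v → sumCube-cong N (h ∘ (v ∷_)))

  sumCube-mono-≤ : ∀ N {f g : Vec (Fin k) N → ℕ} → (∀ x → f x ≤ g x) → sumCube k N f ≤ sumCube k N g
  sumCube-mono-≤ zero    h = h []
  sumCube-mono-≤ (suc N) h = sum-mono-≤ (λ v → sumCube-mono-≤ N (h ∘ (v ∷_)))

  sumCube-distrib-+ : ∀ N (f g : Vec (Fin k) N → ℕ) →
    sumCube k N (λ x → f x + g x) ≡ sumCube k N f + sumCube k N g
  sumCube-distrib-+ zero    f g = refl
  sumCube-distrib-+ (suc N) f g =
    trans (sum-cong-≗ (λ v → sumCube-distrib-+ N (f ∘ (v ∷_)) (g ∘ (v ∷_))))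
          (∑-distrib-+ (λ v → sumCube k N (f ∘ (v ∷_))) (λ v → sumCube k N (g ∘ (v ∷_))))

  sumCube-zero : ∀ N → sumCube k N (λ _ → 0) ≡ 0
  sumCube-zero zero    = refl
  sumCube-zero (suc N) = trans (sum-cong-≗ {k} (λ v → sumCube-zero N)) (sum-replicate-zero k)

  sumCube-one : ∀ N → sumCube k N (λ _ → 1) ≡ k ^ N
  sumCube-one zero    = refl
  sumCube-one (suc N) = trans (sum-cong-≗ {k} (λ v → sumCube-one N)) (sum-const k _)

  term≤sumCube : ∀ N (f : Vec (Fin k) N → ℕ) x → f x ≤ sumCube k N f
  term≤sumCube zero    f []      = ≤-refl
  term≤sumCube (suc N) f (v ∷ x) = ≤-trans (term≤sumCube N _ x) (term≤sum _ v)

  sum-sumCube-comm : ∀ {m} N (f : Fin m → Vec (Fin k) N → ℕ) →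
    ∑[ x < m ] sumCube k N (f x) ≡ sumCube k N (λ c → ∑[ x < m ] f x c)
  sum-sumCube-comm zero    f = refl
  sum-sumCube-comm (suc N) f =
    trans (∑-comm (λ x v → sumCube k N (f x ∘ (v ∷_))))
          (sum-cong-≗ (λ v → sum-sumCube-comm N (λ x c → f x (v ∷ c))))

sumCube-comm : ∀ {k k′} a N (f : Vec (Fin k) a → Vec (Fin k′) N → ℕ) →
  sumCube k a (λ ys → sumCube k′ N (f ys)) ≡ sumCube k′ N (λ zs → sumCube k a (λ ys → f ys zs))
sumCube-comm zero    N f = refl
sumCube-comm (suc a) N f =
  trans (sum-cong-≗ (λ y → sumCube-comm a N (f ∘ (y ∷_))))
        (sum-sumCube-comm N (λ y zs → sumCube _ a (λ ys → f (y ∷ ys) zs)))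

-- The slices of [k]^N, each given by its parametrisation Fin k → Vec (Fin k) N.
sumSlices : (k N : ℕ) → ((Fin k → Vec (Fin k) N) → ℕ) → ℕ
sumSlices k zero    F = 0
sumSlices k (suc N) F =
  sumCube k N (λ c → F (λ x → x ∷ c)) + ∑[ v < k ] sumSlices k N (λ l → F (λ x → v ∷ l x))

sliceCount : ℕ → ℕ → ℕ
sliceCount k zero    = 0
sliceCount k (suc N) = k ^ N + k * sliceCount k N

module _ {k : ℕ} where

  sumSlices-mono-≤ : ∀ N {F G : (Fin k → Vec (Fin k) N) → ℕ} → (∀ l → F l ≤ G l) →
    sumSlices k N F ≤ sumSlices k N G
  sumSlices-mono-≤ zero    h = z≤n
  sumSlices-mono-≤ (suc N) h =
    +-mono-≤ (sumCube-mono-≤ N (λ c → h (λ x → x ∷ c)))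
             (sum-mono-≤ (λ v → sumSlices-mono-≤ N (λ l → h (λ x → v ∷ l x))))

  sumSlices-distrib-+ : ∀ N (F G : (Fin k → Vec (Fin k) N) → ℕ) →
    sumSlices k N (λ l → F l + G l) ≡ sumSlices k N F + sumSlices k N G
  sumSlices-distrib-+ zero    F G = refl
  sumSlices-distrib-+ (suc N) F G = begin
    sumCube k N (λ c → F′ c + G′ c) + ∑[ v < k ] sumSlices k N (λ l → F″ v l + G″ v l)
      ≡⟨ cong₂ _+_ (sumCube-distrib-+ N F′ G′)
                   (trans (sum-cong-≗ (λ v → sumSlices-distrib-+ N (F″ v) (G″ v)))
                          (∑-distrib-+ (λ v → sumSlices k N (F″ v)) (λ v → sumSlices k N (G″ v)))) ⟩
    (sumCube k N F′ + sumCube k N G′) + (∑[ v < k ] sumSlices k N (F″ v) + ∑[ v < k ] sumSlices k N (G″ v))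
      ≡⟨ +-interchange (sumCube k N F′) (sumCube k N G′) _ _ ⟩
    sumSlices k (suc N) F + sumSlices k (suc N) G ∎
    where
    open ≡-Reasoning
    F′ G′ : Vec (Fin k) N → ℕ
    F′ c = F (λ x → x ∷ c)
    G′ c = G (λ x → x ∷ c)
    F″ G″ : Fin k → (Fin k → Vec (Fin k) N) → ℕ
    F″ v l = F (λ x → v ∷ l x)
    G″ v l = G (λ x → v ∷ l x)

  sumSlices-zero : ∀ N → sumSlices k N (λ _ → 0) ≡ 0
  sumSlices-zero zero    = refl
  sumSlices-zero (suc N) =
    cong₂ _+_ (sumCube-zero N) (trans (sum-cong-≗ {k} (λ v → sumSlices-zero N)) (sum-replicate-zero k))

  sumSlices-one : ∀ N → sumSlices k N (λ _ → 1) ≡ sliceCount k N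
  sumSlices-one zero    = refl
  sumSlices-one (suc N) =
    cong₂ _+_ (sumCube-one N) (trans (sum-cong-≗ {k} (λ v → sumSlices-one N)) (sum-const k _))

  sumSlices-sum-comm : ∀ {m} N (F : Fin m → (Fin k → Vec (Fin k) N) → ℕ) →
    sumSlices k N (λ l → ∑[ x < m ] F x l) ≡ ∑[ x < m ] sumSlices k N (F x)
  sumSlices-sum-comm {zero}  N F = sumSlices-zero N
  sumSlices-sum-comm {suc m} N F =
    trans (sumSlices-distrib-+ N (F zero) _) (cong (sumSlices k N (F zero) +_) (sumSlices-sum-comm N (F ∘ suc)))

  sumSlices-sumCube-comm : ∀ {k′} a N (F : Vec (Fin k′) a → (Fin k → Vec (Fin k) N) → ℕ) →
    sumSlices k N (λ l → sumCube k′ a (λ x → F x l)) ≡ sumCube k′ a (λ x → sumSlices k N (F x))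
  sumSlices-sumCube-comm zero    N F = refl
  sumSlices-sumCube-comm (suc a) N F =
    trans (sumSlices-sum-comm N (λ y l → sumCube _ a (λ x → F (y ∷ x) l)))
          (sum-cong-≗ (λ y → sumSlices-sumCube-comm a N (F ∘ (y ∷_))))

sum-map-++ : {A : Set} (h : A → ℕ) (xs ys : List.List A) →
  List.sum (List.map h (xs List.++ ys)) ≡ List.sum (List.map h xs) + List.sum (List.map h ys)
sum-map-++ h xs ys = trans (cong List.sum (List.map-++ h xs ys)) (List.sum-++ (List.map h xs) (List.map h ys))

module _ {A B : Set} where

  sum-map-concatMap : (h : B → ℕ) (f : A → List.List B) (xs : List.List A) →
    List.sum (List.map h (List.concatMap f xs)) ≡ List.sum (List.map (λ x → List.sum (List.map h (f x))) xs)
  sum-map-concatMap h f List.[]       = refl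
  sum-map-concatMap h f (x List.∷ xs) =
    trans (sum-map-++ h (f x) (List.concatMap f xs)) (cong (_ +_) (sum-map-concatMap h f xs))

  sum-map-cartesianProduct : (h : A × B → ℕ) (xs : List.List A) (ys : List.List B) →
    List.sum (List.map h (List.cartesianProduct xs ys)) ≡
    List.sum (List.map (λ x → List.sum (List.map (λ y → h (x , y)) ys)) xs)
  sum-map-cartesianProduct h List.[]       ys = refl
  sum-map-cartesianProduct h (x List.∷ xs) ys =
    trans (sum-map-++ h (List.map (x ,_) ys) (List.cartesianProduct xs ys))
          (cong₂ _+_ (cong List.sum (sym (List.map-∘ ys))) (sum-map-cartesianProduct h xs ys))

sum-tabulate : ∀ {k} (f : Fin k → ℕ) → List.sum (List.tabulate f) ≡ sum f
sum-tabulate {zero}  f = refl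
sum-tabulate {suc k} f = cong (f zero +_) (sum-tabulate (f ∘ suc))

sum-map-allFin : ∀ k (f : Fin k → ℕ) → List.sum (List.map f (List.allFin k)) ≡ sum f
sum-map-allFin k f = trans (cong List.sum (List.map-tabulate (λ x → x) f)) (sum-tabulate f)

sum-map-allVecs : ∀ k N (f : Vec (Fin k) N → ℕ) → List.sum (List.map f (allVecs k N)) ≡ sumCube k N f
sum-map-allVecs k zero    f = +-identityʳ (f [])
sum-map-allVecs k (suc N) f = begin
  List.sum (List.map f (List.concatMap (λ x → List.map (x ∷_) (allVecs k N)) (List.allFin k)))
    ≡⟨ sum-map-concatMap f _ (List.allFin k) ⟩
  List.sum (List.map (λ x → List.sum (List.map f (List.map (x ∷_) (allVecs k N)))) (List.allFin k))
    ≡⟨ sum-map-allFin k _ ⟩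
  ∑[ x < k ] List.sum (List.map f (List.map (x ∷_) (allVecs k N)))
    ≡⟨ sum-cong-≗ (λ x → trans (cong List.sum (sym (List.map-∘ (allVecs k N))))
                               (sum-map-allVecs k N (f ∘ (x ∷_)))) ⟩
  ∑[ x < k ] sumCube k N (f ∘ (x ∷_)) ∎
  where open ≡-Reasoning

sumSlices-insertAt : ∀ k M (F : (Fin k → Vec (Fin k) (suc M)) → ℕ) →
  sumSlices k (suc M) F ≡ ∑[ j < suc M ] sumCube k M (λ c → F (λ x → insertAt c j x))
sumSlices-insertAt k zero    F = cong (F (λ x → x ∷ []) +_) (sum-replicate-zero k)
sumSlices-insertAt k (suc M) F = cong (sumCube k (suc M) (λ c → F (λ x → x ∷ c)) +_) (begin
  ∑[ v < k ] sumSlices k (suc M) (λ l → F (λ x → v ∷ l x))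
    ≡⟨ sum-cong-≗ (λ v → sumSlices-insertAt k M (λ l → F (λ x → v ∷ l x))) ⟩
  ∑[ v < k ] ∑[ j < suc M ] sumCube k M (λ c → F (λ x → v ∷ insertAt c j x))
    ≡⟨ ∑-comm (λ v j → sumCube k M (λ c → F (λ x → v ∷ insertAt c j x))) ⟩
  ∑[ j < suc M ] ∑[ v < k ] sumCube k M (λ c → F (λ x → v ∷ insertAt c j x)) ∎)
  where open ≡-Reasoning

slicesIn-sumCube : ∀ {G M} (S : Subgraph G (suc M)) →
  slicesIn S ≡ ∑[ j < suc M ] sumCube (n G) M (λ c → indicator (containsSlice S j c))
slicesIn-sumCube {G} {M} S = begin
  slicesIn S
    ≡⟨ sum-map-cartesianProduct _ (List.allFin (suc M)) (allVecs (n G) M) ⟩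
  List.sum (List.map (λ j → List.sum (List.map (λ c → indicator (containsSlice S j c)) (allVecs (n G) M)))
                     (List.allFin (suc M)))
    ≡⟨ sum-map-allFin (suc M) _ ⟩
  ∑[ j < suc M ] List.sum (List.map (λ c → indicator (containsSlice S j c)) (allVecs (n G) M))
    ≡⟨ sum-cong-≗ (λ j → sum-map-allVecs (n G) M (λ c → indicator (containsSlice S j c))) ⟩
  ∑[ j < suc M ] sumCube (n G) M (λ c → indicator (containsSlice S j c)) ∎
  where open ≡-Reasoning

-- Embeddings, Cartesian powers and induced subgraphs

When : Bool → Set → Set
When true  A = A
When false A = ⊤

when : ∀ b {A : Set} → A → When b A
when true  a = a
when false _ = tt

When-map : ∀ b {A B : Set} → (A → B) → When b A → When b B
When-map true  f a = f a
When-map false f _ = tt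

When-zip : ∀ b {A B C : Set} → (A → B → C) → When b A → When b B → When b C
When-zip true  f a a′ = f a a′
When-zip false f _ _  = tt

When? : ∀ b {A : Set} → Dec A → Dec (When b A)
When? true  a? = a?
When? false _  = yes tt

record Embedding (induced : Bool) {V W : Set} (E : V → V → Set) (F : W → W → Set) (f : V → W) : Set where
  constructor embedding
  field
    injective : Injective _≡_ _≡_ f
    preserves : ∀ u v → E u v → F (f u) (f v)
    reflects  : When induced (∀ u v → F (f u) (f v) → E u v)
open Embedding

module _ {b : Bool} {U V W : Set} {E : U → U → Set} {F : V → V → Set} {H : W → W → Set} where

  ∘-embedding : {f : U → V} {g : V → W} → Embedding b E F f → Embedding b F H g → Embedding b E H (g ∘ f)
  ∘-embedding ef eg = embedding
    (injective ef ∘ injective eg)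
    (λ u v e → preserves eg _ _ (preserves ef u v e))
    (When-zip b (λ rf rg u v e → rf u v (rg _ _ e)) (reflects ef) (reflects eg))

module _ {b : Bool} {V W : Set} {E : V → V → Set} {F : W → W → Set} where

  embedding-cong : {f g : V → W} → (∀ x → f x ≡ g x) → Embedding b E F f → Embedding b E F g
  embedding-cong f≗g ef = embedding
    (λ {x} {y} eq → injective ef (trans (f≗g x) (trans eq (sym (f≗g y)))))
    (λ u v e → subst₂ F (f≗g u) (f≗g v) (preserves ef u v e))
    (When-map b (λ r u v e → r u v (subst₂ F (sym (f≗g u)) (sym (f≗g v)) e)) (reflects ef))

Copy′ : Bool → (H : Graph) (V : Set) (E : V → V → Set) → Set
Copy′ b H V E = Σ (Fin (n H) → V) (Embedding b (Edge H) E)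

module _ {H : Graph} {V : Set} {E : V → V → Set} where

  fromCopy : Copy H V E → Copy′ false H V E
  fromCopy c = Copy.φ c , embedding (Copy.inj c) (Copy.pres c) tt

  toCopy : Copy′ false H V E → Copy H V E
  toCopy (φ , e) = record { φ = φ ; inj = injective e ; pres = preserves e }

  fromIndCopy : IndCopy H V E → Copy′ true H V E
  fromIndCopy c = IndCopy.φ c , embedding (IndCopy.inj c) (IndCopy.pres c) (IndCopy.refl c)

  toIndCopy : Copy′ true H V E → IndCopy H V E
  toIndCopy (φ , e) = record { φ = φ ; inj = injective e ; pres = preserves e ; refl = reflects e }

Arrow′ : Bool → (r : ℕ) (V : Set) (E : V → V → Set) {m : ℕ} → (Fin m → Graph) → Set
Arrow′ b r V E {m} Fs =
  ∀ (χ : V → Fin r) → Σ (Fin m) λ i → Σ (Copy′ b (Fs i) V E) λ c → ∃ λ k → ∀ u → χ (proj₁ c u) ≡ k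

ZeroSliceDensity′ : Bool → (H G : Graph) → Set
ZeroSliceDensity′ b H G =
  ∀ (ε : ℚ) → ℤ.+ 0 / 1 ℚ.< ε →
  ∃ λ N₀ → ∀ M → N₀ ≤ suc M → ∀ (S : Subgraph G (suc M)) →
    ε ℚ.* toℚ (totalSlices G M) ℚ.≤ toℚ (slicesIn S) → Copy′ b H (SubV S) (SubE S)

module _ {r : ℕ} {V : Set} {E : V → V → Set} {m : ℕ} {Fs : Fin m → Graph} where

  fromArrow : Arrow r V E Fs → Arrow′ false r V E Fs
  fromArrow arrow χ = let i , c , k , mono = arrow χ in i , fromCopy c , k , mono

  toArrow : Arrow′ false r V E Fs → Arrow r V E Fs
  toArrow arrow χ = let i , c , k , mono = arrow χ in i , toCopy c , k , mono

  fromArrowInd : ArrowInd r V E Fs → Arrow′ true r V E Fs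
  fromArrowInd arrow χ = let i , c , k , mono = arrow χ in i , fromIndCopy c , k , mono

  toArrowInd : Arrow′ true r V E Fs → ArrowInd r V E Fs
  toArrowInd arrow χ = let i , c , k , mono = arrow χ in i , toIndCopy c , k , mono

module _ {H F : Graph} where

  fromZeroSliceDensity : ZeroSliceDensity H F → ZeroSliceDensity′ false H F
  fromZeroSliceDensity dense ε ε>0 =
    let N₀ , copies = dense ε ε>0 in N₀ , λ M N₀≤ S ε≤ → fromCopy (copies M N₀≤ S ε≤)

  fromZeroIndSliceDensity : ZeroIndSliceDensity H F → ZeroSliceDensity′ true H F
  fromZeroIndSliceDensity dense ε ε>0 =
    let N₀ , copies = dense ε ε>0 in N₀ , λ M N₀≤ S ε≤ → fromIndCopy (copies M N₀≤ S ε≤)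

Edge? : ∀ G x y → Dec (Edge G x y)
Edge? G x y = adj G x y Bool.≟ true

Edge-sym : ∀ G {x y} → Edge G x y → Edge G y x
Edge-sym G {x} {y} e = trans (Graph.sym G y x) e

Edge-irrefl : ∀ G {x} → ¬ Edge G x x
Edge-irrefl G {x} e with () ← trans (sym (irrefl G x)) e

PowE? : ∀ G N u v → Dec (PowE G N u v)
PowE? G zero    u       v       = no λ ()
PowE? G (suc N) (x ∷ u) (y ∷ v) =
  (Edge? G x y ×-dec Vec.≡-dec Fin._≟_ u v) ⊎-dec (x Fin.≟ y ×-dec PowE? G N u v)

PowE-sym : ∀ G N {u v} → PowE G N u v → PowE G N v u
PowE-sym G (suc N) {x ∷ u} {y ∷ v} (inj₁ (e , eq)) = inj₁ (Edge-sym G e , sym eq)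
PowE-sym G (suc N) {x ∷ u} {y ∷ v} (inj₂ (eq , e)) = inj₂ (sym eq , PowE-sym G N e)

PowE-irrefl : ∀ G N {u} → ¬ PowE G N u u
PowE-irrefl G (suc N) {x ∷ u} (inj₁ (e , _)) = Edge-irrefl G e
PowE-irrefl G (suc N) {x ∷ u} (inj₂ (_ , e)) = PowE-irrefl G N e

embedding? : ∀ b (F G : Graph) (f : Fin (n F) → Fin (n G)) → Dec (Embedding b (Edge F) (Edge G) f)
embedding? b F G f = map′ (λ (i , p , r) → embedding (λ {x} {y} → i x y) p r)
                          (λ e → (λ x y → injective e) , preserves e , reflects e)
                          (injective? ×-dec preserves? ×-dec When? b reflects?)
  where
  injective? : Dec (∀ x y → f x ≡ f y → x ≡ y)
  injective? = Fin.all? λ x → Fin.all? λ y → (f x Fin.≟ f y) →-dec (x Fin.≟ y)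
  preserves? : Dec (∀ u v → Edge F u v → Edge G (f u) (f v))
  preserves? = Fin.all? λ u → Fin.all? λ v → Edge? F u v →-dec Edge? G (f u) (f v)
  reflects? : Dec (∀ u v → Edge G (f u) (f v) → Edge F u v)
  reflects? = Fin.all? λ u → Fin.all? λ v → Edge? G (f u) (f v) →-dec Edge? F u v

insertAt-edge : ∀ G M (c : Vec (Fin (n G)) M) j {x y} → Edge G x y →
  PowE G (suc M) (insertAt c j x) (insertAt c j y)
insertAt-edge G M       c       zero    e = inj₁ (e , refl)
insertAt-edge G (suc M) (z ∷ c) (suc j) e = inj₂ (refl , insertAt-edge G M c j e)

module _ (G : Graph) {t : ℕ} (w : Vec (Fin (n G)) t) where

  ++-preserves : ∀ N u u′ → PowE G N u u′ → PowE G (N + t) (u ++ w) (u′ ++ w)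
  ++-preserves (suc N) (x ∷ u) (y ∷ u′) (inj₁ (e , eq)) = inj₁ (e , cong (_++ w) eq)
  ++-preserves (suc N) (x ∷ u) (y ∷ u′) (inj₂ (eq , e)) = inj₂ (eq , ++-preserves N u u′ e)

  ++-reflects : ∀ N u u′ → PowE G (N + t) (u ++ w) (u′ ++ w) → PowE G N u u′
  ++-reflects zero    []      []       e                = ⊥-elim (PowE-irrefl G t e)
  ++-reflects (suc N) (x ∷ u) (y ∷ u′) (inj₁ (e , eq)) = inj₁ (e , Vec.++-injectiveˡ u u′ eq)
  ++-reflects (suc N) (x ∷ u) (y ∷ u′) (inj₂ (eq , e)) = inj₂ (eq , ++-reflects N u u′ e)

  ++-embedding : ∀ b N → Embedding b (PowE G N) (PowE G (N + t)) (_++ w)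
  ++-embedding b N =
    embedding (λ {u} {u′} → Vec.++-injectiveˡ u u′) (++-preserves N) (when b (++-reflects N))

∧-true : ∀ {a b} → a ∧ b ≡ true → a ≡ true × b ≡ true
∧-true {true} {true} _ = refl , refl

does-sound : ∀ {A : Set} (d : Dec A) → does d ≡ true → A
does-sound (yes a) _ = a

all : ∀ {k} → (Fin k → Bool) → Bool
all {zero}  P = true
all {suc k} P = P zero ∧ all (P ∘ suc)

all-sound : ∀ {k} {P : Fin k → Bool} → all P ≡ true → ∀ x → P x ≡ true
all-sound {suc k} {P} h zero    = proj₁ (∧-true {P zero} h)
all-sound {suc k} {P} h (suc x) = all-sound (proj₂ (∧-true {P zero} h)) x

all-complete : ∀ {k} {P : Fin k → Bool} → (∀ x → P x ≡ true) → all P ≡ true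
all-complete {zero}  h = refl
all-complete {suc k} h rewrite h zero = all-complete (h ∘ suc)

allB-complete : ∀ {A : Set} {P : A → Bool} xs → (∀ x → P x ≡ true) → allB P xs ≡ true
allB-complete List.[]                 h = refl
allB-complete {P = P} (x List.∷ xs) h rewrite h x = allB-complete xs h

inducedSubgraph : ∀ G N → (PowV G N → Bool) → Subgraph G N
inducedSubgraph G N Q = record
  { Vs      = Q
  ; Es      = λ u v → does (PowE? G N u v) ∧ (Q u ∧ Q v)
  ; Es-sym  = λ u v → cong₂ _∧_ (does-⇔ (mk⇔ (PowE-sym G N) (PowE-sym G N)) (PowE? G N u v) (PowE? G N v u))
                                (Bool.∧-comm (Q u) (Q v))
  ; Es-edge = λ u v h → does-sound (PowE? G N u v) (proj₁ (∧-true {does (PowE? G N u v)} h))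
  ; Es-end  = λ u v h → proj₁ (∧-true {Q u} (proj₂ (∧-true {does (PowE? G N u v)} h)))
  }

module _ (G : Graph) (N : ℕ) (Q : PowV G N → Bool) where

  private
    S : Subgraph G N
    S = inducedSubgraph G N Q

  inducedSubgraph-edge : ∀ {u v} → Q u ≡ true → Q v ≡ true → PowE G N u v → Es S u v ≡ true
  inducedSubgraph-edge {u} {v} qu qv e rewrite dec-true (PowE? G N u v) e | qu | qv = refl

  proj₁-embedding : ∀ b → Embedding b (SubE S) (PowE G N) proj₁
  proj₁-embedding b = embedding
    (λ { {x , px} {.x , py} refl → cong (x ,_) (Decidable⇒UIP.≡-irrelevant Bool._≟_ px py) })
    (λ u v → Es-edge S (proj₁ u) (proj₁ v))
    (when b λ { (u , qu) (v , qv) → inducedSubgraph-edge qu qv })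

module _ (G : Graph) (M : ℕ) (Q : PowV G (suc M) → Bool) where

  private
    S : Subgraph G (suc M)
    S = inducedSubgraph G (suc M) Q

  slice-edge : ∀ j c → (∀ x → Q (insertAt c j x) ≡ true) →
    ∀ x y → not (adj G x y) ∨ Es S (insertAt c j x) (insertAt c j y) ≡ true
  slice-edge j c q x y with adj G x y in e
  ... | false = refl
  ... | true  = inducedSubgraph-edge G (suc M) Q (q x) (q y) (insertAt-edge G M c j e)

  containsSlice-inducedSubgraph : ∀ j c → (∀ x → Q (insertAt c j x) ≡ true) → containsSlice S j c ≡ true
  containsSlice-inducedSubgraph j c q rewrite
      allB-complete {P = λ x → Q (insertAt c j x)} (List.allFin (n G)) q
    | allB-complete (List.allFin (n G)) (λ x → allB-complete (List.allFin (n G)) (slice-edge j c q x)) = refl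

  sumSlices≤slicesIn : sumSlices (n G) (suc M) (λ l → indicator (all (Q ∘ l))) ≤ slicesIn S
  sumSlices≤slicesIn = subst₂ _≤_
    (sym (sumSlices-insertAt (n G) M (λ l → indicator (all (Q ∘ l)))))
    (sym (slicesIn-sumCube S))
    (sum-mono-≤ λ j → sumCube-mono-≤ M λ c → monochromatic≤contained j c)
    where
    monochromatic≤contained : ∀ j c →
      indicator (all (λ x → Q (insertAt c j x))) ≤ indicator (containsSlice S j c)
    monochromatic≤contained j c with all (λ x → Q (insertAt c j x)) in eq
    ... | false = z≤n
    ... | true rewrite containsSlice-inducedSubgraph j c (all-sound eq) = ≤-refl

-- Products of F-powers and G-powers along an embedding F → G

any : ∀ {k} → (Fin k → Bool) → Bool
any {zero}  P = false
any {suc k} P = P zero ∨ any (P ∘ suc)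

any-sound : ∀ {k} (P : Fin k → Bool) → any P ≡ true → ∃ λ x → P x ≡ true
any-sound {suc k} P h with P zero in e
... | true  = zero , e
... | false = let x , px = any-sound (P ∘ suc) h in suc x , px

indicator-∨ : ∀ a b → (a ≡ true → b ≡ true → ⊥) → indicator (a ∨ b) ≡ indicator a + indicator b
indicator-∨ true  true  h = ⊥-elim (h refl refl)
indicator-∨ true  false h = refl
indicator-∨ false b     h = refl

indicator-not : ∀ b → indicator b + indicator (not b) ≡ 1
indicator-not true  = refl
indicator-not false = refl

sum-indicator-≟ : ∀ {k} (w : Fin k) (f : Fin k → ℕ) →
  ∑[ v < k ] (indicator (does (w Fin.≟ v)) * f v) ≡ f w
sum-indicator-≟ {suc k} zero    f =
  trans (cong (f zero + 0 +_) (sum-replicate-zero k)) (trans (+-identityʳ _) (+-identityʳ _))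
sum-indicator-≟ {suc k} (suc w) f = sum-indicator-≟ w (f ∘ suc)

inImage : ∀ {p k} → (Fin p → Fin k) → Fin k → Bool
inImage φ v = any (λ y → does (φ y Fin.≟ v))

sum-inImage : ∀ {p k} (φ : Fin p → Fin k) → Injective _≡_ _≡_ φ → (f : Fin k → ℕ) →
  ∑[ v < k ] (indicator (inImage φ v) * f v) ≡ ∑[ y < p ] f (φ y)
sum-inImage {zero}  {k} φ φ-inj f = sum-replicate-zero k
sum-inImage {suc p} {k} φ φ-inj f = begin
  ∑[ v < k ] (indicator (does (φ zero Fin.≟ v) ∨ inImage (φ ∘ suc) v) * f v)
    ≡⟨ sum-cong-≗ (λ v → trans (cong (_* f v) (indicator-∨ _ _ (disjoint v)))
                               (*-distribʳ-+ (f v) (indicator (does (φ zero Fin.≟ v))) _)) ⟩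
  ∑[ v < k ] (indicator (does (φ zero Fin.≟ v)) * f v + indicator (inImage (φ ∘ suc) v) * f v)
    ≡⟨ ∑-distrib-+ (λ v → indicator (does (φ zero Fin.≟ v)) * f v)
                   (λ v → indicator (inImage (φ ∘ suc) v) * f v) ⟩
  ∑[ v < k ] (indicator (does (φ zero Fin.≟ v)) * f v) + ∑[ v < k ] (indicator (inImage (φ ∘ suc) v) * f v)
    ≡⟨ cong₂ _+_ (sum-indicator-≟ (φ zero) f) (sum-inImage (φ ∘ suc) (Fin.suc-injective ∘ φ-inj) f) ⟩
  f (φ zero) + ∑[ y < p ] f (φ (suc y)) ∎
  where
  open ≡-Reasoning
  disjoint : ∀ v → does (φ zero Fin.≟ v) ≡ true → inImage (φ ∘ suc) v ≡ true → ⊥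
  disjoint v h₁ h₂ with y , h₃ ← any-sound _ h₂
    with () ← φ-inj (trans (does-sound (φ zero Fin.≟ v) h₁) (sym (does-sound (φ (suc y) Fin.≟ v) h₃)))

module ImageSplit {p k : ℕ} (φ : Fin p → Fin k) (φ-injective : Injective _≡_ _≡_ φ) where

  outside : Fin k → ℕ
  outside v = indicator (not (inImage φ v))

  sum-split : (f : Fin k → ℕ) → sum f ≡ ∑[ y < p ] f (φ y) + ∑[ v < k ] (outside v * f v)
  sum-split f = begin
    sum f
      ≡⟨ sum-cong-≗ (λ v → sym (trans (sym (*-distribʳ-+ (f v) (indicator (inImage φ v)) (outside v)))
                                       (trans (cong (_* f v) (indicator-not (inImage φ v))) (+-identityʳ (f v))))) ⟩
    ∑[ v < k ] (indicator (inImage φ v) * f v + outside v * f v)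
      ≡⟨ ∑-distrib-+ (λ v → indicator (inImage φ v) * f v) (λ v → outside v * f v) ⟩
    ∑[ v < k ] (indicator (inImage φ v) * f v) + ∑[ v < k ] (outside v * f v)
      ≡⟨ cong (_+ ∑[ v < k ] (outside v * f v)) (sum-inImage φ φ-injective f) ⟩
    ∑[ y < p ] f (φ y) + ∑[ v < k ] (outside v * f v) ∎
    where open ≡-Reasoning

  q : ℕ
  q = sum outside

  p+q≡k : p + q ≡ k
  p+q≡k = begin
    p + q                                        ≡⟨ cong₂ _+_ (sym (trans (sum-const p 1) (*-identityʳ p)))
                                                              (sum-cong-≗ (λ v → sym (*-identityʳ (outside v)))) ⟩
    ∑[ y < p ] 1 + ∑[ v < k ] (outside v * 1)   ≡⟨ sym (sum-split (λ _ → 1)) ⟩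
    ∑[ v < k ] 1                                 ≡⟨ trans (sum-const k 1) (*-identityʳ k) ⟩
    k                                            ∎
    where open ≡-Reasoning

  sum-outside≤ : ∀ (g : Fin k → ℕ) B → (∀ v → g v ≤ B) → ∑[ v < k ] (outside v * g v) ≤ q * B
  sum-outside≤ g B h = ≤-trans (sum-mono-≤ (λ v → *-monoʳ-≤ (outside v) (h v)))
                               (≤-reflexive (*-distribʳ-sum B outside))

module MixedSlices {p k : ℕ} (φ : Fin p → Fin k) (φ-injective : Injective _≡_ _≡_ φ) where

  open ImageSplit φ φ-injective public

  Vertex : ℕ → ℕ → Set
  Vertex a N = Vec (Fin p) a × Vec (Fin k) N

  -- Slices of [p]^a × [k]^N on which R holds everywhere: [p]-slices in a [p]-direction,
  -- and φ-images of [k]-slices in a [k]-direction.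
  monoSlices : ∀ a N → (Vertex a N → Bool) → ℕ
  monoSlices a N R =
      sumCube k N (λ zs → sumSlices p a (λ l → indicator (all (λ x → R (l x , zs)))))
    + sumCube p a (λ ys → sumSlices k N (λ l → indicator (all (λ y → R (ys , l (φ y))))))

  τ : ∀ {a N} → Vertex (suc a) N → Vertex a (suc N)
  τ (ys , zs) = Data.Vec.tail ys , φ (Data.Vec.head ys) ∷ zs

  σ : ∀ {a N} → Fin k → Vertex a N → Vertex a (suc N)
  σ v (ys , zs) = ys , v ∷ zs

  -- The first [k]-coordinate either lies in the image of φ, and then becomes a [p]-coordinate (τ),
  -- or is one of the q values outside it (σ v).
  monoSlices-suc : ∀ a N (R : Vertex a (suc N) → Bool) →
    monoSlices a (suc N) R ≡ monoSlices (suc a) N (R ∘ τ) + ∑[ v < k ] (outside v * monoSlices a N (R ∘ σ v))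
  monoSlices-suc a N R = begin
    monoSlices a (suc N) R
      ≡⟨ cong (LA +_) (sumCube-distrib-+ a (λ ys → sumCube k N (B ys)) (λ ys → ∑[ v < k ] C ys v)) ⟩
    LA + (LB + LC)
      ≡⟨ cong₂ (λ x y → x + (LB + y)) eqA eqC ⟩
    (RA + NA) + (LB + (RC + NC))
      ≡⟨ cong (λ x → (RA + NA) + (x + (RC + NC))) (sumCube-comm a N B) ⟩
    (RA + NA) + (RB + (RC + NC))
      ≡⟨ solve 5 (λ ra na rb rc nc → (ra :+ na) :+ (rb :+ (rc :+ nc)) := ((rb :+ ra) :+ rc) :+ (na :+ nc))
               refl RA NA RB RC NC ⟩
    ((RB + RA) + RC) + (NA + NC)
      ≡⟨ cong₂ (λ x y → (x + RC) + y) (sym (sumCube-distrib-+ N (λ zs → sumCube p a (λ c → B c zs))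
                                                               (λ zs → ∑[ y < p ] A (φ y) zs)))
                                      (sym eqN) ⟩
    monoSlices (suc a) N (R ∘ τ) + ∑[ v < k ] (outside v * monoSlices a N (R ∘ σ v)) ∎
    where
    open ≡-Reasoning
    A : Fin k → Vec (Fin k) N → ℕ
    A v zs = sumSlices p a (λ l → indicator (all (λ x → R (l x , v ∷ zs))))
    B : Vec (Fin p) a → Vec (Fin k) N → ℕ
    B ys c = indicator (all (λ y → R (ys , φ y ∷ c)))
    C : Vec (Fin p) a → Fin k → ℕ
    C ys v = sumSlices k N (λ l → indicator (all (λ y → R (ys , v ∷ l (φ y)))))
    LA LB LC RA RB RC NA NC : ℕ
    LA = ∑[ v < k ] sumCube k N (A v)
    LB = sumCube p a (λ ys → sumCube k N (B ys))
    LC = sumCube p a (λ ys → ∑[ v < k ] C ys v)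
    RA = sumCube k N (λ zs → ∑[ y < p ] A (φ y) zs)
    RB = sumCube k N (λ zs → sumCube p a (λ ys → B ys zs))
    RC = ∑[ y < p ] sumCube p a (λ ys → C ys (φ y))
    NA = ∑[ v < k ] (outside v * sumCube k N (A v))
    NC = ∑[ v < k ] (outside v * sumCube p a (λ ys → C ys v))
    eqA : LA ≡ RA + NA
    eqA = trans (sum-split (λ v → sumCube k N (A v))) (cong (_+ NA) (sum-sumCube-comm N (A ∘ φ)))
    eqC : LC ≡ RC + NC
    eqC = trans (sym (sum-sumCube-comm a (λ v ys → C ys v))) (sum-split (λ v → sumCube p a (λ ys → C ys v)))
    eqN : ∑[ v < k ] (outside v * monoSlices a N (R ∘ σ v)) ≡ NA + NC
    eqN = trans (sum-cong-≗ (λ v → *-distribˡ-+ (outside v) (sumCube k N (A v)) (sumCube p a (λ ys → C ys v))))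
                (∑-distrib-+ (λ v → outside v * sumCube k N (A v))
                             (λ v → outside v * sumCube p a (λ ys → C ys v)))

  monoSlices-zeroˡ : ∀ N (R : Vertex zero N → Bool) →
    monoSlices zero N R ≡ sumSlices k N (λ l → indicator (all (λ y → R ([] , l (φ y)))))
  monoSlices-zeroˡ N R = cong (_+ sumSlices k N (λ l → indicator (all (λ y → R ([] , l (φ y)))))) (sumCube-zero N)

  monoSlices-zeroʳ : ∀ a (R : Vertex a zero → Bool) →
    monoSlices a zero R ≡ sumSlices p a (λ l → indicator (all (λ x → R (l x , []))))
  monoSlices-zeroʳ a R =
    trans (cong (sumSlices p a (λ l → indicator (all (λ x → R (l x , [])))) +_) (sumCube-zero a)) (+-identityʳ _)

_□_ : {V W : Set} → (V → V → Set) → (W → W → Set) → V × W → V × W → Set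
(E □ F) (x , y) (x′ , y′) = (E x x′ × y ≡ y′) ⊎ (x ≡ x′ × F y y′)

module MixedProduct {b : Bool} (F G : Graph) {φ : Fin (n F) → Fin (n G)}
                    (φ-embedding : Embedding b (Edge F) (Edge G) φ) where

  open MixedSlices φ (injective φ-embedding) public

  MixE : ∀ a N → Vertex a N → Vertex a N → Set
  MixE a N = PowE F a □ PowE G N

  τ-embedding : ∀ a N → Embedding b (MixE (suc a) N) (MixE a (suc N)) τ
  τ-embedding a N = embedding inj pres (When-map b refl′ (reflects φ-embedding))
    where
    inj : Injective _≡_ _≡_ τ
    inj {y ∷ ys , zs} {y′ ∷ ys′ , zs′} eq
      with refl ← cong proj₁ eq | eφ , refl ← Vec.∷-injective (cong proj₂ eq)
      with refl ← injective φ-embedding eφ = refl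
    pres : ∀ u v → MixE (suc a) N u v → MixE a (suc N) (τ u) (τ v)
    pres (y ∷ ys , zs) (y′ ∷ ys′ , zs′) (inj₁ (inj₁ (e , eys) , ezs)) =
      inj₂ (eys , inj₁ (preserves φ-embedding y y′ e , ezs))
    pres (y ∷ ys , zs) (y′ ∷ ys′ , zs′) (inj₁ (inj₂ (ey , e) , ezs)) = inj₁ (e , cong₂ _∷_ (cong φ ey) ezs)
    pres (y ∷ ys , zs) (y′ ∷ ys′ , zs′) (inj₂ (refl , e))            = inj₂ (refl , inj₂ (refl , e))
    refl′ : (∀ u v → Edge G (φ u) (φ v) → Edge F u v) →
            ∀ u v → MixE a (suc N) (τ u) (τ v) → MixE (suc a) N u v
    refl′ φ-refl (y ∷ ys , zs) (y′ ∷ ys′ , zs′) (inj₁ (e , eq)) with eφ , ezs ← Vec.∷-injective eq =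
      inj₁ (inj₂ (injective φ-embedding eφ , e) , ezs)
    refl′ φ-refl (y ∷ ys , zs) (y′ ∷ ys′ , zs′) (inj₂ (eys , inj₁ (e , ezs))) =
      inj₁ (inj₁ (φ-refl y y′ e , eys) , ezs)
    refl′ φ-refl (y ∷ ys , zs) (y′ ∷ ys′ , zs′) (inj₂ (eys , inj₂ (eφ , e))) =
      inj₂ (cong₂ _∷_ (injective φ-embedding eφ) eys , e)

  σ-embedding : ∀ a N v → Embedding b (MixE a N) (MixE a (suc N)) (σ v)
  σ-embedding a N v = embedding inj pres (when b refl′)
    where
    inj : Injective _≡_ _≡_ (σ {a} {N} v)
    inj {ys , zs} {ys′ , zs′} eq
      with refl ← cong proj₁ eq | _ , refl ← Vec.∷-injective (cong proj₂ eq) = refl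
    pres : ∀ x y → MixE a N x y → MixE a (suc N) (σ v x) (σ v y)
    pres (ys , zs) (ys′ , zs′) (inj₁ (e , ezs)) = inj₁ (e , cong (v ∷_) ezs)
    pres (ys , zs) (ys′ , zs′) (inj₂ (eys , e)) = inj₂ (eys , inj₂ (refl , e))
    refl′ : ∀ x y → MixE a (suc N) (σ v x) (σ v y) → MixE a N x y
    refl′ (ys , zs) (ys′ , zs′) (inj₁ (e , eq))              = inj₁ (e , Vec.∷-injectiveʳ eq)
    refl′ (ys , zs) (ys′ , zs′) (inj₂ (eys , inj₁ (e , _))) = ⊥-elim (Edge-irrefl G e)
    refl′ (ys , zs) (ys′ , zs′) (inj₂ (eys , inj₂ (_ , e))) = inj₂ (eys , e)

  ,[]-embedding : ∀ a → Embedding b (PowE F a) (MixE a zero) (_, [])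
  ,[]-embedding a = embedding (cong proj₁) (λ u v e → inj₁ (e , refl)) (when b refl′)
    where
    refl′ : ∀ u v → MixE a zero (u , []) (v , []) → PowE F a u v
    refl′ u v (inj₁ (e , _)) = e

  proj₂-embedding : ∀ N → Embedding b (MixE zero N) (PowE G N) proj₂
  proj₂-embedding N = embedding inj pres (when b λ { ([] , zs) ([] , zs′) e → inj₂ (refl , e) })
    where
    inj : Injective _≡_ _≡_ (proj₂ {B = λ _ → Vec (Fin (n G)) N})
    inj {[] , zs} {[] , zs′} = cong ([] ,_)
    pres : ∀ x y → MixE zero N x y → PowE G N (proj₂ x) (proj₂ y)
    pres ([] , zs) ([] , zs′) (inj₂ (_ , e)) = e

-- Counting estimates

mixedSliceCount : ℕ → ℕ → ℕ → ℕ → ℕ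
mixedSliceCount p q a N = sliceCount p a * (p + q) ^ N + p ^ a * sliceCount (p + q) N

mixedSliceCount-suc : ∀ p q a N →
  mixedSliceCount p q (suc a) N + q * mixedSliceCount p q a N ≡ mixedSliceCount p q a (suc N)
mixedSliceCount-suc p q a N =
  solve 6 (λ p q P A W S → (P :+ p :* A) :* W :+ (p :* P) :* S :+ q :* (A :* W :+ P :* S)
                          := A :* ((p :+ q) :* W) :+ P :* (W :+ (p :+ q) :* S))
        refl p q (p ^ a) (sliceCount p a) ((p + q) ^ N) (sliceCount (p + q) N)

sliceCount-suc : ∀ k M → sliceCount k (suc M) ≡ suc M * k ^ M
sliceCount-suc k zero    = cong (1 +_) (*-zeroʳ k)
sliceCount-suc k (suc M) = begin
  k ^ suc M + k * sliceCount k (suc M)  ≡⟨ cong (λ x → k ^ suc M + k * x) (sliceCount-suc k M) ⟩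
  k * k ^ M + k * (suc M * k ^ M)       ≡⟨ solve 3 (λ k A M → k :* A :+ k :* ((con 1 :+ M) :* A)
                                                          := (con 2 :+ M) :* (k :* A)) refl k (k ^ M) M ⟩
  suc (suc M) * k ^ suc M               ∎
  where open ≡-Reasoning

sliceCount≤ : ∀ {p k a s} .{{_ : NonZero k}} → p ≤ k → a ≤ s → sliceCount p a ≤ s * k ^ s
sliceCount≤ {a = zero}                _   _   = z≤n
sliceCount≤ {p} {k} {suc M} {s} p≤k a≤s = begin
  sliceCount p (suc M)  ≡⟨ sliceCount-suc p M ⟩
  suc M * p ^ M         ≤⟨ *-mono-≤ a≤s (≤-trans (^-monoˡ-≤ M p≤k) (^-monoʳ-≤ k (≤-trans (n≤1+n M) a≤s))) ⟩
  s * k ^ s             ∎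
  where open ≤-Reasoning

sliceCount-pos : ∀ k .{{_ : NonZero k}} N → 1 ≤ N → 0 < sliceCount k N
sliceCount-pos k (suc M) _ = ≤-trans (m^n>0 k M) (m≤m+n (k ^ M) _)

^≤*sliceCount : ∀ k N → 1 ≤ N → k ^ N ≤ k * sliceCount k N
^≤*sliceCount k (suc M) _ = begin
  k * k ^ M                  ≤⟨ *-monoʳ-≤ k (m≤m+n (k ^ M) (M * k ^ M)) ⟩
  k * (suc M * k ^ M)        ≡⟨ cong (k *_) (sym (sliceCount-suc k M)) ⟩
  k * sliceCount k (suc M)   ∎
  where open ≤-Reasoning

-- sparseWords q s N counts the words of length N over q + 1 letters that use one fixed letter
-- fewer than s times.
sparseWords : ℕ → ℕ → ℕ → ℕ
sparseWords q zero    N       = 0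
sparseWords q (suc s) zero    = 1
sparseWords q (suc s) (suc N) = sparseWords q s N + q * sparseWords q (suc s) N

∸-suc-cases : ∀ s a → (s ∸ a ≡ 0 × s ∸ suc a ≡ 0) ⊎ (∃ λ t → s ∸ a ≡ suc t × s ∸ suc a ≡ t)
∸-suc-cases zero    zero    = inj₁ (refl , refl)
∸-suc-cases zero    (suc a) = inj₁ (refl , refl)
∸-suc-cases (suc s) zero    = inj₂ (s , refl , refl)
∸-suc-cases (suc s) (suc a) = ∸-suc-cases s a

module _ (q : ℕ) where

  sparseWords-∸-suc : ∀ s a N →
    sparseWords q (s ∸ suc a) N + q * sparseWords q (s ∸ a) N ≤ sparseWords q (s ∸ a) (suc N)
  sparseWords-∸-suc s a N with ∸-suc-cases s a
  ... | inj₁ (e₁ , e₂)     rewrite e₁ | e₂ = ≤-reflexive (*-zeroʳ q)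
  ... | inj₂ (t , e₁ , e₂) rewrite e₁ | e₂ = ≤-refl

  sparseWords-∸-zero : ∀ s a → a < s → sparseWords q (s ∸ a) 0 ≡ 1
  sparseWords-∸-zero s a a<s with ∸-suc-cases s a
  ... | inj₁ (e₁ , _)     = ⊥-elim (<⇒≱ a<s (m∸n≡0⇒m≤n e₁))
  ... | inj₂ (t , e₁ , _) rewrite e₁ = refl

  sparseWords-monoˡ : ∀ s N → sparseWords q s N ≤ sparseWords q (suc s) N
  sparseWords-monoˡ zero    N       = z≤n
  sparseWords-monoˡ (suc s) zero    = ≤-refl
  sparseWords-monoˡ (suc s) (suc N) =
    +-mono-≤ (sparseWords-monoˡ s N) (*-monoʳ-≤ q (sparseWords-monoˡ (suc s) N))

  sparseWords-suc≤ : ∀ s N → sparseWords q s (suc N) ≤ suc q * sparseWords q s N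
  sparseWords-suc≤ zero    N = z≤n
  sparseWords-suc≤ (suc s) N = +-monoˡ-≤ (q * sparseWords q (suc s) N) (sparseWords-monoˡ s N)

  sparseWords-+≤ : ∀ s L N → sparseWords q s (L + N) ≤ suc q ^ L * sparseWords q s N
  sparseWords-+≤ s zero    N = ≤-reflexive (sym (+-identityʳ _))
  sparseWords-+≤ s (suc L) N = begin
    sparseWords q s (suc L + N)            ≤⟨ sparseWords-suc≤ s (L + N) ⟩
    suc q * sparseWords q s (L + N)        ≤⟨ *-monoʳ-≤ (suc q) (sparseWords-+≤ s L N) ⟩
    suc q * (suc q ^ L * sparseWords q s N) ≡⟨ sym (*-assoc (suc q) (suc q ^ L) _) ⟩
    suc q ^ suc L * sparseWords q s N      ∎
    where open ≤-Reasoning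

  sparseWords≤ : ∀ s N → sparseWords q s N ≤ suc q ^ N
  sparseWords≤ zero    N       = z≤n
  sparseWords≤ (suc s) zero    = ≤-refl
  sparseWords≤ (suc s) (suc N) =
    ≤-trans (sparseWords-suc≤ (suc s) N) (*-monoʳ-≤ (suc q) (sparseWords≤ (suc s) N))

  sparseWords-block : ∀ s L N →
    sparseWords q (suc s) (L + N) ≤ suc q ^ L * sparseWords q s N + q ^ L * sparseWords q (suc s) N
  sparseWords-block s zero    N = ≤-trans (m≤n+m (sparseWords q (suc s) N) (sparseWords q s N))
    (≤-reflexive (solve 2 (λ A B → A :+ B := con 1 :* A :+ con 1 :* B) refl
                          (sparseWords q s N) (sparseWords q (suc s) N)))
  sparseWords-block s (suc L) N = begin
    sparseWords q s (L + N) + q * sparseWords q (suc s) (L + N)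
      ≤⟨ +-mono-≤ (sparseWords-+≤ s L N) (*-monoʳ-≤ q (sparseWords-block s L N)) ⟩
    suc q ^ L * A + q * (suc q ^ L * A + q ^ L * B)
      ≡⟨ solve 5 (λ q P A Q B → P :* A :+ q :* (P :* A :+ Q :* B) := (P :+ q :* P) :* A :+ (q :* Q) :* B)
               refl q (suc q ^ L) A (q ^ L) B ⟩
    suc q ^ suc L * A + q ^ suc L * B ∎
    where
    open ≤-Reasoning
    A = sparseWords q s N
    B = sparseWords q (suc s) N

  sparseWords-blocks : ∀ s L → sparseWords q s (s * L) * suc q ^ L ≤ s * q ^ L * suc q ^ (s * L)
  sparseWords-blocks zero    L = z≤n
  sparseWords-blocks (suc s) L = begin
    sparseWords q (suc s) (L + s * L) * Q ^ L
      ≤⟨ *-monoˡ-≤ (Q ^ L) (sparseWords-block s L (s * L)) ⟩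
    (Q ^ L * A + q ^ L * sparseWords q (suc s) (s * L)) * Q ^ L
      ≤⟨ *-monoˡ-≤ (Q ^ L) (+-monoʳ-≤ (Q ^ L * A) (*-monoʳ-≤ (q ^ L) (sparseWords≤ (suc s) (s * L)))) ⟩
    (Q ^ L * A + q ^ L * Q ^ (s * L)) * Q ^ L
      ≡⟨ solve 4 (λ P A R S → (P :* A :+ R :* S) :* P := P :* (A :* P) :+ R :* S :* P)
               refl (Q ^ L) A (q ^ L) (Q ^ (s * L)) ⟩
    Q ^ L * (A * Q ^ L) + q ^ L * Q ^ (s * L) * Q ^ L
      ≤⟨ +-monoˡ-≤ (q ^ L * Q ^ (s * L) * Q ^ L) (*-monoʳ-≤ (Q ^ L) (sparseWords-blocks s L)) ⟩
    Q ^ L * (s * q ^ L * Q ^ (s * L)) + q ^ L * Q ^ (s * L) * Q ^ L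
      ≡⟨ solve 4 (λ s P R S → P :* (s :* R :* S) :+ R :* S :* P := (con 1 :+ s) :* R :* (P :* S))
               refl s (Q ^ L) (q ^ L) (Q ^ (s * L)) ⟩
    suc s * q ^ L * (Q ^ L * Q ^ (s * L))
      ≡⟨ cong (suc s * q ^ L *_) (sym (^-distribˡ-+-* Q L (s * L))) ⟩
    suc s * q ^ L * Q ^ (L + s * L) ∎
    where
    open ≤-Reasoning
    Q A : ℕ
    Q = suc q
    A = sparseWords q s (s * L)

bernoulli : ∀ q L → q ^ suc L + L * q ^ L ≤ q * suc q ^ L
bernoulli q zero    = ≤-reflexive (+-identityʳ _)
bernoulli q (suc L) = begin
  q ^ suc (suc L) + suc L * q ^ suc L
    ≤⟨ m≤m+n _ (L * q ^ L) ⟩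
  q ^ suc (suc L) + suc L * q ^ suc L + L * q ^ L
    ≡⟨ solve 3 (λ q A L → q :* (q :* A) :+ (con 1 :+ L) :* (q :* A) :+ L :* A
                       := (con 1 :+ q) :* (q :* A :+ L :* A)) refl q (q ^ L) L ⟩
  suc q * (q ^ suc L + L * q ^ L)
    ≤⟨ *-monoʳ-≤ (suc q) (bernoulli q L) ⟩
  suc q * (q * suc q ^ L)
    ≡⟨ solve 3 (λ q A B → A :* (q :* B) := q :* (A :* B)) refl q (suc q) (suc q ^ L) ⟩
  q * suc q ^ suc L ∎
  where open ≤-Reasoning

Z*q^L<[1+q]^L : ∀ q Z L → Z * q ≤ L → 1 ≤ L → Z * q ^ L < suc q ^ L
Z*q^L<[1+q]^L zero       Z (suc L) _ _ = ≤-trans (s≤s (≤-reflexive (*-zeroʳ Z))) (m^n>0 1 (suc L))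
Z*q^L<[1+q]^L q@(suc _) Z L       h _ = *-cancelˡ-< q (Z * q ^ L) (suc q ^ L) (begin-strict
  q * (Z * q ^ L)       ≡⟨ solve 3 (λ q Z A → q :* (Z :* A) := Z :* q :* A) refl q Z (q ^ L) ⟩
  Z * q * q ^ L         <⟨ m<n+m (Z * q * q ^ L) (m^n>0 q (suc L)) ⟩
  q ^ suc L + Z * q * q ^ L ≤⟨ +-monoʳ-≤ (q ^ suc L) (*-monoˡ-≤ (q ^ L) h) ⟩
  q ^ suc L + L * q ^ L ≤⟨ bernoulli q L ⟩
  q * suc q ^ L         ∎)
  where open ≤-Reasoning

sparseWords-negligible : ∀ {q k} X s L → q < k → 1 ≤ X → 1 ≤ s → X * s * k * k ≤ L →
  X * sparseWords q s (s * L) < sliceCount k (s * L)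
sparseWords-negligible {q} {k@(suc _)} X s L q<k X≥1 s≥1 Zk≤L =
  *-cancelʳ-< (Q ^ L * k) (X * sparseWords q s (s * L)) (sliceCount k (s * L)) (begin-strict
    X * sparseWords q s (s * L) * (Q ^ L * k)
      ≡⟨ solve 4 (λ X F P k → X :* F :* (P :* k) := X :* (F :* P) :* k) refl X (sparseWords q s (s * L)) (Q ^ L) k ⟩
    X * (sparseWords q s (s * L) * Q ^ L) * k
      ≤⟨ *-monoˡ-≤ k (*-monoʳ-≤ X (sparseWords-blocks q s L)) ⟩
    X * (s * q ^ L * Q ^ (s * L)) * k
      ≡⟨ solve 5 (λ X s R S k → X :* (s :* R :* S) :* k := X :* s :* k :* R :* S)
               refl X s (q ^ L) (Q ^ (s * L)) k ⟩
    Z * q ^ L * Q ^ (s * L)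
      <⟨ *-monoˡ-< (Q ^ (s * L)) {{m^n≢0 Q (s * L)}} (Z*q^L<[1+q]^L q Z L Zq≤L L≥1) ⟩
    Q ^ L * Q ^ (s * L)
      ≤⟨ *-monoʳ-≤ (Q ^ L) (^-monoˡ-≤ (s * L) q<k) ⟩
    Q ^ L * k ^ (s * L)
      ≤⟨ *-monoʳ-≤ (Q ^ L) (^≤*sliceCount k (s * L) (*-mono-≤ s≥1 L≥1)) ⟩
    Q ^ L * (k * sliceCount k (s * L))
      ≡⟨ solve 3 (λ P k S → P :* (k :* S) := S :* (P :* k)) refl (Q ^ L) k (sliceCount k (s * L)) ⟩
    sliceCount k (s * L) * (Q ^ L * k) ∎)
  where
  open ≤-Reasoning
  Q Z : ℕ
  Q = suc q
  Z = X * s * k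
  instance
    _ : NonZero (Q ^ L * k)
    _ = m*n≢0 (Q ^ L) k {{m^n≢0 Q L}}
  Zq≤L : Z * q ≤ L
  Zq≤L = ≤-trans (*-monoʳ-≤ Z (<⇒≤ q<k)) Zk≤L
  L≥1 : 1 ≤ L
  L≥1 = ≤-trans (*-mono-≤ (*-mono-≤ (*-mono-≤ X≥1 s≥1) (s≤s z≤n)) (s≤s z≤n)) Zk≤L

0<1/[1+D] : ∀ D → ℤ.+ 0 / 1 ℚ.< ℤ.+ 1 / suc D
0<1/[1+D] D = ℚ.toℚᵘ-cancel-<
  (ℚᵘ.<-respˡ-≃ (ℚᵘ.≃-sym (ℚ.toℚᵘ-fromℚᵘ (mkℚᵘ (ℤ.+ 0) 0)))
  (ℚᵘ.<-respʳ-≃ (ℚᵘ.≃-sym (ℚ.toℚᵘ-fromℚᵘ (mkℚᵘ (ℤ.+ 1) D))) (*<* (ℤ.+<+ (s≤s z≤n)))))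

1/[1+D]*a≤b : ∀ D a b → a ≤ suc D * b → (ℤ.+ 1 / suc D) ℚ.* toℚ a ℚ.≤ toℚ b
1/[1+D]*a≤b D a b a≤[1+D]b =
  ℚ.toℚᵘ-cancel-≤ (ℚᵘ.≤-respˡ-≃ (ℚᵘ.≃-sym lhs) (ℚᵘ.≤-respʳ-≃ (ℚᵘ.≃-sym rhs) (*≤* cross)))
  where
  lhs : ℚ.toℚᵘ ((ℤ.+ 1 / suc D) ℚ.* toℚ a) ℚᵘ.≃ mkℚᵘ (ℤ.+ 1) D ℚᵘ.* mkℚᵘ (ℤ.+ a) 0
  lhs = ℚᵘ.≃-trans (ℚ.toℚᵘ-homo-* (ℤ.+ 1 / suc D) (toℚ a))
                   (ℚᵘ.*-cong (ℚ.toℚᵘ-fromℚᵘ (mkℚᵘ (ℤ.+ 1) D)) (ℚ.toℚᵘ-fromℚᵘ (mkℚᵘ (ℤ.+ a) 0)))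
  rhs : ℚ.toℚᵘ (toℚ b) ℚᵘ.≃ mkℚᵘ (ℤ.+ b) 0
  rhs = ℚ.toℚᵘ-fromℚᵘ (mkℚᵘ (ℤ.+ b) 0)
  cross : ℤ.+ 1 ℤ.* ℤ.+ a ℤ.* ℤ.+ 1 ℤ.≤ ℤ.+ b ℤ.* (ℤ.+ suc D ℤ.* ℤ.+ 1)
  cross = subst₂ ℤ._≤_
    (sym (trans (ℤ.*-identityʳ _) (ℤ.*-identityˡ _)))
    (trans (ℤ.pos-* b (suc D)) (cong (ℤ.+ b ℤ.*_) (sym (ℤ.*-identityʳ _))))
    (ℤ.+≤+ (subst (a ≤_) (*-comm (suc D) b) a≤[1+D]b))

-- The density argument

first-or-all : ∀ {k} {A : Set} {B : Fin k → Set} → (∀ v → A ⊎ B v) → A ⊎ (∀ v → B v)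
first-or-all {zero}  h = inj₂ λ ()
first-or-all {suc k} h with h zero | first-or-all (h ∘ suc)
... | inj₁ a  | _       = inj₁ a
... | inj₂ _  | inj₁ a  = inj₁ a
... | inj₂ b₀ | inj₂ bs = inj₂ λ { zero → b₀ ; (suc v) → bs v }

module MonochromaticCopy
  {b : Bool} (F G H : Graph) {V : Set} {E : V → V → Set} (P : V → Bool)
  {φ : Fin (n F) → Fin (n G)} (φ-embedding : Embedding b (Edge F) (Edge G) φ)
  (D K s : ℕ) (s≥1 : 1 ≤ s) (small : ∀ a → a < s → sliceCount (n F) a ≤ K)
  (dense : ∀ M → s ≤ suc M → (S : Subgraph F (suc M)) →
           totalSlices F M ≤ D * slicesIn S → Copy′ b H (SubV S) (SubE S))
  where

  open MixedProduct F G φ-embedding public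

  GoodCopy : Set
  GoodCopy = Σ (Copy′ b H V E) λ c → ∀ u → P (proj₁ c u) ≡ true

  -- Below (a, N) the recursion has sparseWords q (s ∸ a) N leaves with fewer than s [p]-coordinates,
  -- and each of them contributes at most K slices.
  bound : ℕ → ℕ → ℕ
  bound a N = mixedSliceCount (n F) q a N + D * K * sparseWords q (s ∸ a) N

  monoSlices≤sliceCount : ∀ a (Q : Vec (Fin (n F)) a → Bool) →
    sumSlices (n F) a (λ l → indicator (all (Q ∘ l))) ≤ sliceCount (n F) a
  monoSlices≤sliceCount a Q =
    ≤-trans (sumSlices-mono-≤ a (λ l → indicator≤1 (all (Q ∘ l)))) (≤-reflexive (sumSlices-one a))
    where
    indicator≤1 : ∀ c → indicator c ≤ 1
    indicator≤1 true  = ≤-refl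
    indicator≤1 false = z≤n

  sliceCount≤bound : ∀ a → sliceCount (n F) a ≤ bound a zero
  sliceCount≤bound a = ≤-trans (≤-reflexive (sym (*-identityʳ _))) (≤-trans (m≤m+n _ _) (m≤m+n _ _))

  leafColouring : ∀ {a} → (Vertex a zero → V) → Vec (Fin (n F)) a → Bool
  leafColouring e ys = P (e (ys , []))

  leafSubgraph : ∀ {a} → (Vertex a zero → V) → Subgraph F a
  leafSubgraph {a} e = inducedSubgraph F a (leafColouring e)

  copy-or-sparse-dense : ∀ M → s ≤ suc M → (e : Vertex (suc M) zero → V) → Embedding b (MixE (suc M) zero) E e →
    GoodCopy ⊎ D * monoSlices (suc M) zero (P ∘ e) ≤ bound (suc M) zero
  copy-or-sparse-dense M s≤a e e-embedding with totalSlices F M ≤? D * slicesIn (leafSubgraph e)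
  ... | yes h = inj₁ ((e ∘ (_, []) ∘ proj₁ ∘ proj₁ c , c-embedding) , proj₂ ∘ proj₁ c)
    where
    c : Copy′ b H (SubV (leafSubgraph e)) (SubE (leafSubgraph e))
    c = dense M s≤a (leafSubgraph e) h
    c-embedding : Embedding b (Edge H) E (e ∘ (_, []) ∘ proj₁ ∘ proj₁ c)
    c-embedding = ∘-embedding (proj₂ c) (∘-embedding (proj₁-embedding F (suc M) (leafColouring e) b)
                                                     (∘-embedding (,[]-embedding (suc M)) e-embedding))
  ... | no h = inj₂ (begin
    D * monoSlices (suc M) zero (P ∘ e)
      ≡⟨ cong (D *_) (monoSlices-zeroʳ (suc M) (P ∘ e)) ⟩
    D * sumSlices (n F) (suc M) (λ l → indicator (all (leafColouring e ∘ l)))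
      ≤⟨ *-monoʳ-≤ D (sumSlices≤slicesIn F M (leafColouring e)) ⟩
    D * slicesIn (leafSubgraph e)
      ≤⟨ <⇒≤ (≰⇒> h) ⟩
    totalSlices F M
      ≡⟨ sym (sliceCount-suc (n F) M) ⟩
    sliceCount (n F) (suc M)
      ≤⟨ sliceCount≤bound (suc M) ⟩
    bound (suc M) zero ∎)
    where open ≤-Reasoning

  copy-or-sparse-leaf : ∀ a (e : Vertex a zero → V) → Embedding b (MixE a zero) E e →
    GoodCopy ⊎ D * monoSlices a zero (P ∘ e) ≤ bound a zero
  copy-or-sparse-leaf a e e-embedding with s ≤? a
  copy-or-sparse-leaf zero    e e-embedding | yes s≤0 = ⊥-elim (<⇒≱ s≥1 s≤0)
  copy-or-sparse-leaf (suc M) e e-embedding | yes s≤a = copy-or-sparse-dense M s≤a e e-embedding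
  copy-or-sparse-leaf a       e e-embedding | no  s≰a = inj₂ (begin
    D * monoSlices a zero (P ∘ e)
      ≡⟨ cong (D *_) (monoSlices-zeroʳ a (P ∘ e)) ⟩
    D * sumSlices (n F) a (λ l → indicator (all (leafColouring e ∘ l)))
      ≤⟨ *-monoʳ-≤ D (≤-trans (monoSlices≤sliceCount a (leafColouring e)) (small a (≰⇒> s≰a))) ⟩
    D * K
      ≡⟨ sym (trans (cong (D * K *_) (sparseWords-∸-zero q s a (≰⇒> s≰a))) (*-identityʳ (D * K))) ⟩
    D * K * sparseWords q (s ∸ a) zero
      ≤⟨ m≤n+m _ _ ⟩
    bound a zero ∎)
    where open ≤-Reasoning

  bound-suc : ∀ a N → bound (suc a) N + q * bound a N ≤ bound a (suc N)
  bound-suc a N = begin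
    (I₁ + X * S₁) + q * (I₀ + X * S₀)
      ≡⟨ solve 6 (λ I₁ S₁ I₀ S₀ q X → (I₁ :+ X :* S₁) :+ q :* (I₀ :+ X :* S₀)
                                   := (I₁ :+ q :* I₀) :+ X :* (S₁ :+ q :* S₀))
               refl I₁ S₁ I₀ S₀ q X ⟩
    (I₁ + q * I₀) + X * (S₁ + q * S₀)
      ≤⟨ +-mono-≤ (≤-reflexive (mixedSliceCount-suc (n F) q a N)) (*-monoʳ-≤ X (sparseWords-∸-suc q s a N)) ⟩
    bound a (suc N) ∎
    where
    open ≤-Reasoning
    X I₁ I₀ S₁ S₀ : ℕ
    X  = D * K
    I₁ = mixedSliceCount (n F) q (suc a) N
    I₀ = mixedSliceCount (n F) q a N
    S₁ = sparseWords q (s ∸ suc a) N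
    S₀ = sparseWords q (s ∸ a) N

  copy-or-sparse : ∀ N a (e : Vertex a N → V) → Embedding b (MixE a N) E e →
    GoodCopy ⊎ D * monoSlices a N (P ∘ e) ≤ bound a N
  copy-or-sparse zero    a e e-embedding = copy-or-sparse-leaf a e e-embedding
  copy-or-sparse (suc N) a e e-embedding
    with copy-or-sparse N (suc a) (e ∘ τ) (∘-embedding (τ-embedding a N) e-embedding)
       | first-or-all (λ v → copy-or-sparse N a (e ∘ σ v) (∘-embedding (σ-embedding a N v) e-embedding))
  ... | inj₁ c  | _       = inj₁ c
  ... | inj₂ _  | inj₁ c  = inj₁ c
  ... | inj₂ h₁ | inj₂ hσ = inj₂ (begin
    D * monoSlices a (suc N) (P ∘ e)
      ≡⟨ cong (D *_) (monoSlices-suc a N (P ∘ e)) ⟩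
    D * (Mτ + ∑[ v < n G ] (outside v * Mσ v))
      ≡⟨ *-distribˡ-+ D Mτ _ ⟩
    D * Mτ + D * ∑[ v < n G ] (outside v * Mσ v)
      ≡⟨ cong (D * Mτ +_) (trans (*-distribˡ-sum D (λ v → outside v * Mσ v))
                                 (sum-cong-≗ (λ v → *-comm-middle D (outside v) (Mσ v)))) ⟩
    D * Mτ + ∑[ v < n G ] (outside v * (D * Mσ v))
      ≤⟨ +-mono-≤ h₁ (sum-outside≤ (λ v → D * Mσ v) (bound a N) hσ) ⟩
    bound (suc a) N + q * bound a N
      ≤⟨ bound-suc a N ⟩
    bound a (suc N) ∎)
    where
    open ≤-Reasoning
    Mτ : ℕ
    Mτ = monoSlices (suc a) N (P ∘ e ∘ τ)
    Mσ : Fin (n G) → ℕ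
    Mσ v = monoSlices a N (P ∘ e ∘ σ v)
    *-comm-middle : ∀ x y z → x * (y * z) ≡ y * (x * z)
    *-comm-middle x y z = solve 3 (λ x y z → x :* (y :* z) := y :* (x :* z)) refl x y z

-- Popular copies and the proof of the theorem

argmax : ∀ {k} (f : Fin (suc k) → ℕ) → ∃ λ x → ∀ y → f y ≤ f x
argmax {zero}  f = zero , λ { zero → ≤-refl }
argmax {suc k} f with argmax (f ∘ suc)
... | x , fx-max with f zero ≤? f (suc x)
...   | yes f0≤fx = suc x , λ { zero → f0≤fx ; (suc y) → fx-max y }
...   | no  f0≰fx = zero  , λ { zero → ≤-refl ; (suc y) → ≤-trans (fx-max y) (<⇒≤ (≰⇒> f0≰fx)) }

pigeonhole : ∀ {k} (f : Fin k → ℕ) c T → 0 < T → T ≤ c * sum f → ∃ λ x → T ≤ c * k * f x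
pigeonhole {zero}  f c T T>0 T≤ = ⊥-elim (<⇒≱ T>0 (≤-trans T≤ (≤-reflexive (*-zeroʳ c))))
pigeonhole {suc k} f c T T>0 T≤ with x , fx-max ← argmax f = x , (begin
  T                    ≤⟨ T≤ ⟩
  c * sum f            ≤⟨ *-monoʳ-≤ c (sum-mono-≤ fx-max) ⟩
  c * ∑[ _ < suc k ] f x ≡⟨ cong (c *_) (sum-const (suc k) (f x)) ⟩
  c * (suc k * f x)    ≡⟨ sym (*-assoc c (suc k) (f x)) ⟩
  c * suc k * f x      ∎)
  where open ≤-Reasoning

pigeonhole-cube : ∀ {k} N (f : Vec (Fin k) N → ℕ) c T → 0 < T → T ≤ c * sumCube k N f →
  ∃ λ w → T ≤ c * k ^ N * f w
pigeonhole-cube zero f c T T>0 T≤ = [] , ≤-trans T≤ (≤-reflexive (cong (_* f []) (sym (*-identityʳ c))))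
pigeonhole-cube {k} (suc N) f c T T>0 T≤
  with v , T≤v ← pigeonhole (λ v → sumCube k N (f ∘ (v ∷_))) c T T>0 T≤
  with w , T≤w ← pigeonhole-cube N (f ∘ (v ∷_)) (c * k) T T>0 T≤v
  = v ∷ w , ≤-trans T≤w (≤-reflexive (cong (_* f (v ∷ w)) (*-assoc c k (k ^ N))))

module PopularCopy {b : Bool} {r m : ℕ} {Gs : Fin m → Graph} {G : Graph}
                   (arrow : Arrow′ b r (Fin (n G)) (Edge G) Gs) where

  popularity : ℕ
  popularity = m * n G ^ (∑[ i < m ] n (Gs i)) * r

  coefficient≤popularity : .{{_ : NonZero (n G)}} → ∀ i → 1 * m * n G ^ n (Gs i) * r ≤ popularity
  coefficient≤popularity i = *-monoˡ-≤ r (≤-trans (≤-reflexive (cong (_* n G ^ n (Gs i)) (*-identityˡ m)))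
                                                 (*-monoʳ-≤ m (^-monoʳ-≤ (n G) (term≤sum (λ i → n (Gs i)) i))))

  module _ {N : ℕ} (χ : PowV G N → Fin r) where

    Slice : Set
    Slice = Fin (n G) → PowV G N

    monochromatic : ∀ {p} → (Fin p → Fin (n G)) → Fin r → Slice → Bool
    monochromatic φ k l = all (λ x → does (χ (l (φ x)) Fin.≟ k))

    -- A vector w encodes the map lookup w : V(Gs i) → V(G), so that maps can be summed over by sumCube.
    monoCopy : (i : Fin m) → Vec (Fin (n G)) (n (Gs i)) → Fin r → Slice → Bool
    monoCopy i w k l = does (embedding? b (Gs i) G (lookup w)) ∧ monochromatic (lookup w) k l

    copiesAt : (i : Fin m) → Slice → Vec (Fin (n G)) (n (Gs i)) → ℕ
    copiesAt i l w = ∑[ k < r ] indicator (monoCopy i w k l)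

    monoCopies : Slice → ℕ
    monoCopies l = ∑[ i < m ] sumCube (n G) (n (Gs i)) (copiesAt i l)

    monoCopies≥1 : ∀ l → 1 ≤ monoCopies l
    monoCopies≥1 l with i , (φ , φ-embedding) , k , mono ← arrow (χ ∘ l) = begin
      1                                    ≡⟨ cong indicator (sym isMonoCopy) ⟩
      indicator (monoCopy i w k l)         ≤⟨ term≤sum (λ k → indicator (monoCopy i w k l)) k ⟩
      copiesAt i l w                       ≤⟨ term≤sumCube (n (Gs i)) (copiesAt i l) w ⟩
      sumCube (n G) (n (Gs i)) (copiesAt i l)
                                           ≤⟨ term≤sum (λ i → sumCube (n G) (n (Gs i)) (copiesAt i l)) i ⟩
      monoCopies l                         ∎
      where
      open ≤-Reasoning
      w : Vec (Fin (n G)) (n (Gs i))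
      w = tabulate φ
      isMonoCopy : monoCopy i w k l ≡ true
      isMonoCopy rewrite dec-true (embedding? b (Gs i) G (lookup w))
                                  (embedding-cong (λ x → sym (Vec.lookup∘tabulate φ x)) φ-embedding)
        = all-complete (λ x → dec-true (χ (l (lookup w x)) Fin.≟ k)
                                       (trans (cong (χ ∘ l) (Vec.lookup∘tabulate φ x)) (mono x)))

    sliceCount≤monoCopies : sliceCount (n G) N ≤
      ∑[ i < m ] sumCube (n G) (n (Gs i)) λ w → ∑[ k < r ] sumSlices (n G) N (indicator ∘ monoCopy i w k)
    sliceCount≤monoCopies = begin
      sliceCount (n G) N            ≡⟨ sym (sumSlices-one N) ⟩
      sumSlices (n G) N (λ _ → 1)   ≤⟨ sumSlices-mono-≤ N monoCopies≥1 ⟩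
      sumSlices (n G) N monoCopies  ≡⟨ sumSlices-sum-comm N (λ i l → sumCube (n G) (n (Gs i)) (copiesAt i l)) ⟩
      ∑[ i < m ] sumSlices (n G) N (λ l → sumCube (n G) (n (Gs i)) (copiesAt i l))
        ≡⟨ sum-cong-≗ (λ i → trans (sumSlices-sumCube-comm (n (Gs i)) N (λ w l → copiesAt i l w))
                                   (sumCube-cong (n (Gs i)) λ w →
                                      sumSlices-sum-comm N (λ k → indicator ∘ monoCopy i w k))) ⟩
      ∑[ i < m ] sumCube (n G) (n (Gs i)) (λ w → ∑[ k < r ] sumSlices (n G) N (indicator ∘ monoCopy i w k)) ∎
      where open ≤-Reasoning

    positive⇒yes : ∀ {A : Set} {mono : Slice → Bool} (d : Dec A) → 0 < sliceCount (n G) N →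
      sliceCount (n G) N ≤ popularity * sumSlices (n G) N (λ l → indicator (does d ∧ mono l)) →
      A × sliceCount (n G) N ≤ popularity * sumSlices (n G) N (indicator ∘ mono)
    positive⇒yes (yes a) _   T≤ = a , T≤
    positive⇒yes (no _)  T>0 T≤ = ⊥-elim (<⇒≱ T>0 (≤-trans T≤ (≤-reflexive
                                    (trans (cong (popularity *_) (sumSlices-zero N)) (*-zeroʳ popularity)))))

    popular : .{{_ : NonZero (n G)}} → 0 < sliceCount (n G) N →
      Σ (Fin m) λ i → Σ (Fin (n (Gs i)) → Fin (n G)) λ φ → Embedding b (Edge (Gs i)) (Edge G) φ ×
        ∃ λ k → sliceCount (n G) N ≤ popularity * sumSlices (n G) N (indicator ∘ monochromatic φ k)
    popular T>0
      with i , T≤ᵢ ← pigeonhole _ 1 _ T>0 (≤-trans sliceCount≤monoCopies (≤-reflexive (sym (*-identityˡ _))))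
      with w , T≤w ← pigeonhole-cube (n (Gs i)) _ (1 * m) _ T>0 T≤ᵢ
      with k , T≤k ← pigeonhole _ (1 * m * n G ^ n (Gs i)) _ T>0 T≤w
      with φ-embedding , T≤mono ← positive⇒yes (embedding? b (Gs i) G (lookup w)) T>0
                                    (≤-trans T≤k (*-monoˡ-≤ _ (coefficient≤popularity i)))
      = i , lookup w , φ-embedding , k , T≤mono

popular-bounded : ∀ {T S B} C → T ≤ C * S → suc (C + C) * S ≤ T + B → T ≤ B
popular-bounded {T} {S} {B} C T≤CS DS≤T+B = +-cancelˡ-≤ T T B (begin
  T + T            ≤⟨ +-mono-≤ T≤CS T≤CS ⟩
  C * S + C * S    ≡⟨ sym (*-distribʳ-+ S C C) ⟩
  (C + C) * S      ≤⟨ m≤n+m _ S ⟩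
  suc (C + C) * S  ≤⟨ DS≤T+B ⟩
  T + B            ∎)
  where open ≤-Reasoning

module LargeDimension
  {b : Bool} {r m : ℕ} {Gs Hs : Fin m → Graph} {G : Graph}
  (dense : ∀ i → ZeroSliceDensity′ b (Hs i) (Gs i))
  (arrow : Arrow′ b r (Fin (n G)) (Edge G) Gs)
  (nonempty : ∀ i → 1 ≤ n (Gs i))
  .{{_ : NonZero (n G)}}
  where

  open PopularCopy {Gs = Gs} {G = G} arrow using (popularity; popular; monochromatic)

  D′ D : ℕ
  D′ = popularity + popularity
  D  = suc D′

  ε : ℚ
  ε = ℤ.+ 1 / D

  N₀ : Fin m → ℕ
  N₀ i = proj₁ (dense i ε (0<1/[1+D] D′))

  s K X L dimension : ℕ
  s = suc (∑[ i < m ] N₀ i)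
  K = s * n G ^ s
  X = D * K
  L = X * s * n G * n G
  dimension = s * L

  X≥1 : 1 ≤ X
  X≥1 = *-mono-≤ {1} {D} {1} {K} (s≤s z≤n) (*-mono-≤ {1} {s} {1} (s≤s z≤n) (m^n>0 (n G) s))

  dense-beyond-s : ∀ i M → s ≤ suc M → (S : Subgraph (Gs i) (suc M)) →
    totalSlices (Gs i) M ≤ D * slicesIn S → Copy′ b (Hs i) (SubV S) (SubE S)
  dense-beyond-s i M s≤1+M S h = proj₂ (dense i ε (0<1/[1+D] D′)) M
    (≤-trans (term≤sum N₀ i) (≤-trans (n≤1+n _) s≤1+M)) S (1/[1+D]*a≤b D′ _ _ h)

  dimension≥1 : 1 ≤ dimension
  dimension≥1 = *-mono-≤ {1} {s} {1} {L} (s≤s z≤n)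
    (*-mono-≤ {1} {X * s * n G} (*-mono-≤ {1} {X * s} (*-mono-≤ {1} {X} {1} {s} X≥1 (s≤s z≤n)) nG≥1) nG≥1)
    where
    nG≥1 : 1 ≤ n G
    nG≥1 = >-nonZero⁻¹ (n G)

  sliceCount>0 : 0 < sliceCount (n G) dimension
  sliceCount>0 = sliceCount-pos (n G) dimension dimension≥1

  module _ (χ : PowV G dimension → Fin r) (i : Fin m) {φ : Fin (n (Gs i)) → Fin (n G)}
           (φ-embedding : Embedding b (Edge (Gs i)) (Edge G) φ) (k : Fin r) where

    small : ∀ a → a < s → sliceCount (n (Gs i)) a ≤ K
    small a a<s = sliceCount≤ (Fin.injective⇒≤ (injective φ-embedding)) (<⇒≤ a<s)

    colour-k : PowV G dimension → Bool
    colour-k u = does (χ u Fin.≟ k)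

    open MonochromaticCopy (Gs i) G (Hs i) {E = PowE G dimension} colour-k φ-embedding
                           D K s (s≤s z≤n) small (dense-beyond-s i)

    q<nG : q < n G
    q<nG = ≤-trans (+-monoˡ-≤ q (nonempty i)) (≤-reflexive p+q≡k)

    bound-top : bound zero dimension ≡ sliceCount (n G) dimension + X * sparseWords q s dimension
    bound-top = cong (_+ X * sparseWords q s dimension)
                     (trans (+-identityʳ _) (cong (λ k → sliceCount k dimension) p+q≡k))

    monoSlices-top : monoSlices zero dimension (colour-k ∘ proj₂) ≡
                     sumSlices (n G) dimension (indicator ∘ monochromatic χ φ k)
    monoSlices-top = monoSlices-zeroˡ dimension (colour-k ∘ proj₂)

    negligible : X * sparseWords q s dimension < sliceCount (n G) dimension
    negligible = sparseWords-negligible X s L q<nG X≥1 (s≤s z≤n) ≤-refl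

    copy-from-popular :
      sliceCount (n G) dimension ≤ popularity * sumSlices (n G) dimension (indicator ∘ monochromatic χ φ k) →
      Σ (Copy′ b (Hs i) (PowV G dimension) (PowE G dimension)) λ c → ∀ u → χ (proj₁ c u) ≡ k
    copy-from-popular T≤CS =
      [ (λ (c , good) → c , λ u → does-sound (χ (proj₁ c u) Fin.≟ k) (good u))
      , (λ sparse → ⊥-elim (<⇒≱ negligible (popular-bounded popularity T≤CS
                             (subst₂ _≤_ (cong (D *_) monoSlices-top) bound-top sparse))))
      ]′ (copy-or-sparse dimension zero proj₂ (proj₂-embedding dimension))

  arrow-dimension : Arrow′ b r (PowV G dimension) (PowE G dimension) Hs
  arrow-dimension χ =
    let i , φ , φ-embedding , k , T≤CS = popular χ sliceCount>0
        c , mono                      = copy-from-popular χ i φ-embedding k T≤CS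
    in i , c , k , mono

arrow-pad : ∀ {b r m} {Hs : Fin m → Graph} (G : Graph) {N} → Fin (n G) →
  Arrow′ b r (PowV G N) (PowE G N) Hs → ∀ t → Arrow′ b r (PowV G (N + t)) (PowE G (N + t)) Hs
arrow-pad {b} G {N} v₀ arrow t χ with i , (φ , φ-embedding) , k , mono ← arrow (χ ∘ (_++ replicate t v₀)) =
  i , ((_++ replicate t v₀) ∘ φ , ∘-embedding φ-embedding (++-embedding G (replicate t v₀) b N)) , k , mono

arrow-mono : ∀ {b r m} {Hs : Fin m → Graph} (G : Graph) {N} → Fin (n G) →
  Arrow′ b r (PowV G N) (PowE G N) Hs → ∀ N′ → N ≤ N′ → Arrow′ b r (PowV G N′) (PowE G N′) Hs
arrow-mono {b} {r} {Hs = Hs} G {N} v₀ arrow N′ N≤N′ =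
  subst (λ N′ → Arrow′ b r (PowV G N′) (PowE G N′) Hs) (m+[n∸m]≡n N≤N′)
        (arrow-pad {Hs = Hs} G v₀ arrow (N′ ∸ N))

Fin0-elim : ∀ {k} → k ≡ 0 → Fin k → ⊥
Fin0-elim refl ()

emptyCopy : ∀ {b} H {V : Set} {E : V → V → Set} → n H ≡ 0 → Copy′ b H V E
emptyCopy {b} H nH≡0 =
  ⊥-elim ∘ empty , embedding (λ {x} → ⊥-elim (empty x)) (⊥-elim ∘ empty) (when b (⊥-elim ∘ empty))
  where
  empty : Fin (n H) → ⊥
  empty = Fin0-elim nH≡0

-- If F has no vertices then even the empty subgraph contains all (zero) F-slices.
density-empty : ∀ {b H F} → ZeroSliceDensity′ b H F → n F ≡ 0 → n H ≡ 0
density-empty {H = H} {F} dense nF≡0 = noVertices (proj₁ copy)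
  where
  N₀ : ℕ
  N₀ = proj₁ (dense (ℤ.+ 1 / 1) (0<1/[1+D] 0))
  S : Subgraph F (suc (suc N₀))
  S = inducedSubgraph F (suc (suc N₀)) (λ _ → false)
  noSlices : totalSlices F (suc N₀) ≡ 0
  noSlices = trans (cong (λ k → suc (suc N₀) * (k * k ^ N₀)) nF≡0) (*-zeroʳ (suc (suc N₀)))
  copy : Copy′ _ H (SubV S) (SubE S)
  copy = proj₂ (dense (ℤ.+ 1 / 1) (0<1/[1+D] 0)) (suc N₀) (≤-trans (n≤1+n N₀) (n≤1+n (suc N₀))) S
           (1/[1+D]*a≤b 0 (totalSlices F (suc N₀)) (slicesIn S) (subst (_≤ 1 * slicesIn S) (sym noSlices) z≤n))
  noVertices : ∀ {k} → (Fin k → SubV S) → k ≡ 0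
  noVertices {zero}  _ = refl
  noVertices {suc k} φ with () ← proj₂ (φ zero)

nonZero-Fin : ∀ {k} → Fin k → NonZero k
nonZero-Fin zero    = _
nonZero-Fin (suc _) = _

eventually-arrow-nonempty : ∀ {b r m} {Gs Hs : Fin m → Graph} {G : Graph} →
  (∀ i → ZeroSliceDensity′ b (Hs i) (Gs i)) → Arrow′ b r (Fin (n G)) (Edge G) Gs →
  (∀ i → 1 ≤ n (Gs i)) → Fin (n G) →
  ∃ λ N₀ → ∀ N → N₀ ≤ N → Arrow′ b r (PowV G N) (PowE G N) Hs
eventually-arrow-nonempty {Gs = Gs} {Hs} {G} dense arrow nonempty v₀ =
  dimension , arrow-mono {Hs = Hs} G v₀ arrow-dimension
  where open LargeDimension {Gs = Gs} {Hs} {G} dense arrow nonempty {{nonZero-Fin v₀}}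

arrow-emptyGraph : ∀ {b r m} {Gs Hs : Fin m → Graph} {V : Set} {E : V → V → Set} → 1 ≤ r →
  ∀ i → ZeroSliceDensity′ b (Hs i) (Gs i) → n (Gs i) ≡ 0 → Arrow′ b r V E Hs
arrow-emptyGraph {r = suc _} {Gs = Gs} {Hs} _ i dense empty χ =
  i , emptyCopy (Hs i) nH≡0 , zero , ⊥-elim ∘ Fin0-elim nH≡0
  where
  nH≡0 : n (Hs i) ≡ 0
  nH≡0 = density-empty {H = Hs i} {F = Gs i} dense empty

eventually-arrow : ∀ {b r m} {Gs Hs : Fin m → Graph} {G : Graph} → 1 ≤ r →
  (∀ i → ZeroSliceDensity′ b (Hs i) (Gs i)) → Arrow′ b r (Fin (n G)) (Edge G) Gs →
  ∃ λ N₀ → ∀ N → N₀ ≤ N → Arrow′ b r (PowV G N) (PowE G N) Hs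
eventually-arrow {b} {r@(suc _)} {Gs = Gs} {Hs} {G} r≥1 dense arrow = cases (Fin.any? (λ i → n (Gs i) ≟ 0))
  where
  cases : Dec (∃ λ i → n (Gs i) ≡ 0) → ∃ λ N₀ → ∀ N → N₀ ≤ N → Arrow′ b r (PowV G N) (PowE G N) Hs
  cases (yes (i , empty)) = 0 , λ N _ → arrow-emptyGraph {Gs = Gs} {Hs} r≥1 i (dense i) empty
  cases (no  nonempty)    = eventually-arrow-nonempty {Gs = Gs} {Hs} {G} dense arrow nonempty′ v₀
    where
    nonempty′ : ∀ i → 1 ≤ n (Gs i)
    nonempty′ i = n≢0⇒n>0 λ empty → nonempty (i , empty)
    v₀ : Fin (n G)
    v₀ = let i , (φ , _) , _ = arrow (λ _ → zero) in φ (fromℕ< (nonempty′ i))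

theorem1p2 : (r : ℕ) → 1 ≤ r → (m : ℕ) → (Gs Hs : Fin m → Graph) → (G : Graph) →
    ((∀ i → ZeroSliceDensity (Hs i) (Gs i)) →
      Arrow r (Fin (n G)) (Edge G) Gs →
      ∃ λ N₀ → ∀ N → N₀ ≤ N → Arrow r (PowV G N) (PowE G N) Hs)
    × ((∀ i → ZeroIndSliceDensity (Hs i) (Gs i)) →
      ArrowInd r (Fin (n G)) (Edge G) Gs →
      ∃ λ N₀ → ∀ N → N₀ ≤ N → ArrowInd r (PowV G N) (PowE G N) Hs)
theorem1p2 r r≥1 m Gs Hs G =
  (λ dense arrow →
    let N₀ , arrows = eventually-arrow {Gs = Gs} {Hs} {G} r≥1 (fromZeroSliceDensity ∘ dense) (fromArrow arrow)
    in N₀ , λ N N₀≤N → toArrow (arrows N N₀≤N)) ,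
  (λ dense arrow →
    let N₀ , arrows = eventually-arrow {Gs = Gs} {Hs} {G} r≥1 (fromZeroIndSliceDensity ∘ dense) (fromArrowInd arrow)
    in N₀ , λ N N₀≤N → toArrowInd (arrows N N₀≤N))
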